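{- Let $\partial$ be any of $\partial_{\mathrm{del}},\partial_{\mathrm{clp}},\partial_{\mathrm{con}},\partial_{\mathrm{lp}}$. For homogeneous $a,b\in\mathcal M_\bullet$, $\partial(a\star b)=\partial(a)\star b+(-1)^{|a|}a\star\partial(b)$, where $|a|$ is the degree (ground-set size) of $a$.
   Context: An orientation of a matroid $\mathsf M$ is a generator $\eta$ of $\bigwedge^{|E|}\mathbb{Z}\langle E\rangle$, $E=E(\mathsf M)$. $\mathcal M$ is the $\mathbb{Q}$-vector space spanned by symbols $[\mathsf M,\eta]$ modulo $[\mathsf M,-\eta]=-[\mathsf M,\eta]$ and $[\mathsf M,\eta]=[\mathsf M',\psi_*\eta]$ for every matroid isomorphism $\psi:\mathsf M\to\mathsf M'$ ($\psi_*$ the induced map on top exterior powers), graded by ground-set size ($\mathcal M_\bullet$). Product: $[\mathsf M,\eta]\star[\mathsf Q,\omega]=[\mathsf M\oplus\mathsf Q,\eta\wedge\omega]$. With $\iota_x$ interior product ($\iota_x(x\wedge\alpha)=\alpha$): $\partial_{\mathrm{del}}[\mathsf M,\eta]=\sum_{x\text{ not a coloop}}[\mathsf M\setminus x,\iota_x\eta]$, $\partial_{\mathrm{clp}}$ the same sum over coloops, $\partial_{\mathrm{con}}[\mathsf M,\eta]=\sum_{x\text{ not a loop}}[\mathsf M/x,\iota_x\eta]$, $\partial_{\mathrm{lp}}$ the same sum over loops. -}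

module Defs where

open import Data.Bool using (Bool; true; false; not; _∧_; if_then_else_)
import Data.Bool.Properties as BoolP
open import Data.Nat using (ℕ; zero; suc; _+_; _<ᵇ_)
open import Data.Fin using (Fin; toℕ)
open import Data.Fin.Subset using (Subset; _∈_; _∉_; _⊆_; ⁅_⁆; _∪_; ∣_∣; inside; outside)
  renaming (⊥ to ∅)
open import Data.Fin.Subset.Properties using (_∈?_; _⊆?_)
open import Data.Fin.Permutation using (Permutation′; _⟨$⟩ʳ_; _⟨$⟩ˡ_)
open import Data.Vec using (Vec; []; _∷_; insertAt; take; drop; tabulate; lookup)
import Data.Vec.Properties as VecP
open import Data.List using (List; foldr; map; allFin)
open import Data.Nat.ListAction using (sum)
open import Data.Sign using (Sign; opposite) renaming (_*_ to _*ˢ_; + to ⁺; - to ⁻)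
open import Data.Rational using (ℚ; 1ℚ; -_)
open import Data.Rational using () renaming (_+_ to _+ℚ_; _*_ to _*ℚ_)
open import Data.Product using (Σ; _×_; _,_; ∃)
open import Data.Nat using (_<_)
open import Relation.Binary.PropositionalEquality using (_≡_)
open import Relation.Nullary using (Dec; yes; no; does; ¬_)
open import Relation.Nullary.Decidable using (_×-dec_; _→-dec_; map′)
open import Relation.Unary using (Pred; Decidable)

record SetSystem (n : ℕ) : Set where
  constructor setSystem
  field indep : Subset n → Bool
open SetSystem public

record IsMatroid {n : ℕ} (M : SetSystem n) : Set where
  field
    I1 : indep M ∅ ≡ true
    I2 : ∀ I J → I ⊆ J → indep M J ≡ true → indep M I ≡ true
    I3 : ∀ I J → indep M I ≡ true → indep M J ≡ true → ∣ I ∣ < ∣ J ∣ →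
         ∃ λ y → y ∈ J × y ∉ I × indep M (⁅ y ⁆ ∪ I) ≡ true

IsBasis : ∀ {n} → SetSystem n → Subset n → Set
IsBasis M B = (indep M B ≡ true) × (∀ T → B ⊆ T → indep M T ≡ true → T ≡ B)

IsLoop : ∀ {n} → SetSystem n → Fin n → Set
IsLoop M x = indep M ⁅ x ⁆ ≡ false

IsColoop : ∀ {n} → SetSystem n → Fin n → Set
IsColoop M x = ∀ B → IsBasis M B → x ∈ B

allSubset? : ∀ {n} {P : Subset n → Set} → (∀ S → Dec (P S)) → Dec (∀ S → P S)
allSubset? {zero} P? with P? []
... | yes p = yes λ { [] → p }
... | no ¬p = no λ f → ¬p (f [])
allSubset? {suc n} P? with allSubset? (λ S → P? (true ∷ S)) | allSubset? (λ S → P? (false ∷ S))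
... | yes a | yes b = yes λ { (true ∷ S) → a S ; (false ∷ S) → b S }
... | no ¬a | _ = no λ f → ¬a (λ S → f (true ∷ S))
... | yes _ | no ¬b = no λ f → ¬b (λ S → f (false ∷ S))

isBasis? : ∀ {n} (M : SetSystem n) B → Dec (IsBasis M B)
isBasis? M B = (indep M B BoolP.≟ true) ×-dec
  allSubset? (λ T → (B ⊆? T) →-dec ((indep M T BoolP.≟ true) →-dec VecP.≡-dec BoolP._≟_ T B))

isLoop? : ∀ {n} (M : SetSystem n) x → Dec (IsLoop M x)
isLoop? M x = indep M ⁅ x ⁆ BoolP.≟ false

isColoop? : ∀ {n} (M : SetSystem n) x → Dec (IsColoop M x)
isColoop? M x = allSubset? (λ B → isBasis? M B →-dec (x ∈? B))

-- Deleting/contracting x ∈ Fin (suc n) yields a set system on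
-- Fin n, where j : Fin n stands for the element punchIn x j of the old
-- ground set (order-preserving relabelling; this is what `insertAt` does).

delete : ∀ {n} → SetSystem (suc n) → Fin (suc n) → SetSystem n
delete M x = setSystem λ S → indep M (insertAt S x false)

-- M / x : I independent iff I ∪ B_x independent in M, where B_x is a
-- basis of {x}, i.e. B_x = {x} if x is not a loop and B_x = ∅ if x is a loop.
contract : ∀ {n} → SetSystem (suc n) → Fin (suc n) → SetSystem n
contract M x = setSystem λ S → indep M (insertAt S x (not (does (isLoop? M x))))

_⊕ₘ_ : ∀ {m n} → SetSystem m → SetSystem n → SetSystem (m + n)
_⊕ₘ_ {m} M Q = setSystem λ S → indep M (take m S) ∧ indep Q (drop m S)

-- Orientations.  The top exterior power of ℤ⟨Fin n⟩ is generated by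
-- std = e₀ ∧ e₁ ∧ ... ∧ e_{n-1}; an orientation is  s · std  with s a sign.

signPow : ℕ → Sign
signPow zero = ⁺
signPow (suc k) = opposite (signPow k)

inversions : ∀ {n} → (Fin n → Fin n) → ℕ
inversions {n} f = sum (map (λ i → sum (map (λ j →
  if (toℕ i <ᵇ toℕ j) ∧ (toℕ (f j) <ᵇ toℕ (f i)) then 1 else 0) (allFin n))) (allFin n))

sgn : ∀ {n} → Permutation′ n → Sign
sgn σ = signPow (inversions (σ ⟨$⟩ʳ_))

image : ∀ {n} → Permutation′ n → Subset n → Subset n
image σ S = tabulate λ j → lookup S (σ ⟨$⟩ˡ j)

record Iso {n : ℕ} (M M' : SetSystem n) : Set where
  field
    perm : Permutation′ n
    pres : ∀ S → indep M' (image perm S) ≡ indep M S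
open Iso public

-- ψ_*(s · e₀∧…∧e_{n-1}) = s · e_{ψ0}∧…∧e_{ψ(n-1)} = (sgn ψ · s) · std

-- The vector space 𝓜 by generators and relations.
-- Terms: formal ℚ-linear expressions in symbols [M, s·std].

infixl 6 _⊕_
infixr 7 _·_

data Term : Set where
  gen  : ∀ {n} → SetSystem n → Sign → Term
  𝟘    : Term
  _⊕_  : Term → Term → Term
  _·_  : ℚ → Term → Term

-- congruence generated by the ℚ-vector space axioms (giving the free
-- ℚ-vector space on the symbols) together with the defining relations
-- of 𝓜:  [M,-η] = -[M,η]  and  [M,η] = [M',ψ_*η].
infix 4 _≈_
data _≈_ : Term → Term → Set where
  ≈-refl  : ∀ {a} → a ≈ a
  ≈-sym   : ∀ {a b} → a ≈ b → b ≈ a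
  ≈-trans : ∀ {a b c} → a ≈ b → b ≈ c → a ≈ c
  ⊕-cong  : ∀ {a a' b b'} → a ≈ a' → b ≈ b' → a ⊕ b ≈ a' ⊕ b'
  ·-cong  : ∀ {q a a'} → a ≈ a' → q · a ≈ q · a'
  ⊕-assoc : ∀ a b c → (a ⊕ b) ⊕ c ≈ a ⊕ (b ⊕ c)
  ⊕-comm  : ∀ a b → a ⊕ b ≈ b ⊕ a
  ⊕-idˡ   : ∀ a → 𝟘 ⊕ a ≈ a
  ⊕-invˡ  : ∀ a → (- 1ℚ) · a ⊕ a ≈ 𝟘
  ·-one   : ∀ a → 1ℚ · a ≈ a
  ·-assoc : ∀ p q a → p · (q · a) ≈ (p *ℚ q) · a
  ·-distʳ : ∀ p q a → (p +ℚ q) · a ≈ p · a ⊕ q · a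
  ·-distˡ : ∀ p a b → p · (a ⊕ b) ≈ p · a ⊕ p · b
  rel-sign : ∀ {n} (M : SetSystem n) s → gen M (opposite s) ≈ (- 1ℚ) · gen M s
  rel-iso  : ∀ {n} {M M' : SetSystem n} (ψ : Iso M M') s →
             gen M s ≈ gen M' (sgn (perm ψ) *ˢ s)

data AllDeg (d : ℕ) : Term → Set where
  gen : ∀ (M : SetSystem d) s → IsMatroid M → AllDeg d (gen M s)
  𝟘   : AllDeg d 𝟘
  _⊕_ : ∀ {a b} → AllDeg d a → AllDeg d b → AllDeg d (a ⊕ b)
  _·_ : ∀ q {a} → AllDeg d a → AllDeg d (q · a)

Homogeneous : ℕ → Term → Set
Homogeneous d a = Σ Term λ a' → (a ≈ a') × AllDeg d a'

-- Product, extended bilinearly:  [M,η] ⋆ [Q,ω] = [M ⊕ Q, η ∧ ω],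
-- (s·std_m) ∧ (t·std_n) = (s t)·std_{m+n}.

genL : ∀ {m} → SetSystem m → Sign → Term → Term
genL M s (gen Q t) = gen (M ⊕ₘ Q) (s *ˢ t)
genL M s 𝟘 = 𝟘
genL M s (b ⊕ b') = genL M s b ⊕ genL M s b'
genL M s (q · b) = q · genL M s b

infixl 7 _⋆_
_⋆_ : Term → Term → Term
gen M s ⋆ b = genL M s b
𝟘 ⋆ b = 𝟘
(a ⊕ a') ⋆ b = a ⋆ b ⊕ a' ⋆ b
(q · a) ⋆ b = q · (a ⋆ b)

-- The four operators.  ι_{e_i}(e₀∧…∧e_n) = (-1)^i e₀∧…ê_i…∧e_n.

data Which : Set where
  del clp con lp : Which

select : Which → ∀ {n} → SetSystem (suc n) → Fin (suc n) → Bool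
select del M x = not (does (isColoop? M x))
select clp M x = does (isColoop? M x)
select con M x = not (does (isLoop? M x))
select lp  M x = does (isLoop? M x)

minor : Which → ∀ {n} → SetSystem (suc n) → Fin (suc n) → SetSystem n
minor del = delete
minor clp = delete
minor con = contract
minor lp  = contract

∂gen : Which → ∀ {n} → SetSystem n → Sign → Term
∂gen w {zero} M s = 𝟘
∂gen w {suc n} M s = foldr _⊕_ 𝟘 (map (λ x →
  if select w M x then gen (minor w M x) (signPow (toℕ x) *ˢ s) else 𝟘) (allFin (suc n)))

∂ : Which → Term → Term
∂ w (gen M s) = ∂gen w M s
∂ w 𝟘 = 𝟘
∂ w (a ⊕ b) = ∂ w a ⊕ ∂ w b
∂ w (q · a) = q · ∂ w a

negOnePow : ℕ → ℚ
negOnePow zero = 1ℚ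
negOnePow (suc k) = - negOnePow k

{-# OPTIONS --safe #-}
-- ∂ and ⋆ are defined on generators and extended linearly, and both respect the relations
-- of 𝓜: an isomorphism ψ : M → M′ restricts to isomorphisms between the minors at x and at
-- ψ x (given by remove x ψ), and sgn ψ = (-1)^(x + ψ x) · sgn (remove x ψ) accounts for the
-- signs (-1)^x and (-1)^(ψ x) of the interior products; for ⋆ one uses ψ ⊕ φ, whose sign is
-- sgn ψ · sgn φ. So the rule need only be checked on generators, where
-- [M,η] ⋆ [Q,ω] = [M ⊕ Q, η ∧ ω]. The m elements of M come first in M ⊕ Q; loops and coloops
-- of M ⊕ Q are those of M and of Q (a basis of M ⊕ Q is a basis of M next to one of Q), and
-- the minor at the i-th, resp. (m + j)-th, element is the minor of M at i next to Q, resp. M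
-- next to the minor of Q at j; the interior product at position m + j carries the extra
-- sign (-1)^m.

module Submission where

open import Defs
open import Level using (0ℓ)
open import Function using (_∘_)
open import Data.Bool using (Bool; true; false; not; _∧_; if_then_else_)
open import Data.Nat using (ℕ; zero; suc; _+_; _<ᵇ_; _≤_; s≤s)
import Data.Nat.Properties as ℕ
open import Data.Fin using (Fin; toℕ; _↑ˡ_; _↑ʳ_; punchIn; punchOut; splitAt; join)
  renaming (zero to fzero; suc to fsuc)
import Data.Fin.Properties as Fin
open import Data.Fin.Permutation using (Permutation′; _⟨$⟩ʳ_; _⟨$⟩ˡ_; permutation; remove; punchIn-permute)
import Data.Fin.Permutation as Perm
import Data.Sum as Sum
import Data.Sum.Properties as Sum
open import Data.List using (foldr; map; allFin; tabulate)
import Data.List.Properties as List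
open import Data.Sign using (Sign; opposite) renaming (_*_ to _*ˢ_; + to ⁺; - to ⁻)
import Data.Sign.Properties as Sign
open import Algebra.Solver.CommutativeMonoid Sign.*-commutativeMonoid using (solve; _⊜_) renaming (_⊕_ to _⊛_)
open import Data.Rational using (ℚ; 1ℚ; -_) renaming (_*_ to _*ℚ_)
import Data.Rational.Properties as ℚ
open import Data.Product using (Σ; _,_; _×_; proj₁; proj₂)
open import Data.Sum using (_⊎_; inj₁; inj₂)
open import Data.Empty using (⊥-elim)
open import Data.Vec using (Vec; []; _∷_; lookup; insertAt; take; drop; _++_; cast; here; there)
open import Data.Vec.Relation.Binary.Equality.Cast using (cast-is-id)
import Data.Vec.Properties as Vec
open import Data.Fin.Subset using (Subset; _∈_; _⊆_; _⊂_; ⁅_⁆; ∣_∣; inside; outside) renaming (⊥ to ∅)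
import Data.Fin.Subset.Properties as Subset
open import Function.Bundles using (_⇔_; mk⇔)
open import Relation.Nullary using (does; yes; no; ¬_)
import Data.Bool.Properties as Bool
open import Relation.Nullary.Decidable using (does-⇔; _×-dec_)
open import Relation.Binary.PropositionalEquality
  using (_≡_; refl; sym; trans; cong; cong₂; subst; module ≡-Reasoning)
open import Relation.Binary.Structures using (IsEquivalence)
open import Relation.Binary.Bundles using (Setoid)
open import Algebra.Bundles using (Monoid; CommutativeMonoid)
import Algebra.Properties.Monoid.Sum as MonoidSum
import Algebra.Properties.CommutativeMonoid.Sum as CommutativeMonoidSum
import Algebra.Properties.CommutativeSemigroup as CommutativeSemigroupProperties
import Relation.Binary.Reasoning.Setoid

module _ {c ℓ} (M : Monoid c ℓ) where
  open Monoid M using (Carrier; _∙_; ε; ∙-congˡ; assoc; identityˡ)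
    renaming (_≈_ to _≈ᴹ_; sym to ≈ᴹ-sym; trans to ≈ᴹ-trans)
  open MonoidSum M using (sum)

  foldr-map-allFin : ∀ n (f : Fin n → Carrier) → foldr _∙_ ε (map f (allFin n)) ≡ sum f
  foldr-map-allFin n f = trans (cong (foldr _∙_ ε) (List.map-tabulate (λ i → i) f)) (foldr-tabulate n f)
    where
    foldr-tabulate : ∀ n (g : Fin n → Carrier) → foldr _∙_ ε (tabulate g) ≡ sum g
    foldr-tabulate zero    g = refl
    foldr-tabulate (suc n) g = cong (g fzero ∙_) (foldr-tabulate n (g ∘ fsuc))

  sum-↑ : ∀ m {n} (f : Fin (m + n) → Carrier) → sum f ≈ᴹ sum (f ∘ (_↑ˡ n)) ∙ sum (f ∘ (m ↑ʳ_))
  sum-↑ zero    f = ≈ᴹ-sym (identityˡ _)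
  sum-↑ (suc m) f = ≈ᴹ-trans (∙-congˡ (sum-↑ m (f ∘ fsuc))) (≈ᴹ-sym (assoc _ _ _))

≈-isEquivalence : IsEquivalence _≈_
≈-isEquivalence = record { refl = ≈-refl ; sym = ≈-sym ; trans = ≈-trans }

≈-setoid : Setoid 0ℓ 0ℓ
≈-setoid = record { isEquivalence = ≈-isEquivalence }

open IsEquivalence ≈-isEquivalence using () renaming (reflexive to ≈-reflexive)

⊕-identityʳ : ∀ a → a ⊕ 𝟘 ≈ a
⊕-identityʳ a = ≈-trans (⊕-comm a 𝟘) (⊕-idˡ a)

⊕-𝟘-commutativeMonoid : CommutativeMonoid 0ℓ 0ℓ
⊕-𝟘-commutativeMonoid = record
  { isCommutativeMonoid = record
    { isMonoid = record
      { isSemigroup = record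
        { isMagma = record { isEquivalence = ≈-isEquivalence ; ∙-cong = ⊕-cong }
        ; assoc = ⊕-assoc }
      ; identity = ⊕-idˡ , ⊕-identityʳ }
    ; comm = ⊕-comm } }

open CommutativeMonoidSum ⊕-𝟘-commutativeMonoid using (sum; sum-cong-≋; sum-permute)
open CommutativeSemigroupProperties (CommutativeMonoid.commutativeSemigroup ⊕-𝟘-commutativeMonoid)
  using (interchange)
module ≈-Reasoning = Relation.Binary.Reasoning.Setoid ≈-setoid

x≈x⊕x⇒x≈𝟘 : ∀ {x} → x ≈ x ⊕ x → x ≈ 𝟘
x≈x⊕x⇒x≈𝟘 {x} x≈x⊕x = begin
  x                          ≈⟨ ⊕-idˡ x ⟨
  𝟘 ⊕ x                      ≈⟨ ⊕-cong (⊕-invˡ x) ≈-refl ⟨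
  ((- 1ℚ) · x ⊕ x) ⊕ x       ≈⟨ ⊕-assoc _ _ _ ⟩
  (- 1ℚ) · x ⊕ (x ⊕ x)       ≈⟨ ⊕-cong ≈-refl x≈x⊕x ⟨
  (- 1ℚ) · x ⊕ x             ≈⟨ ⊕-invˡ x ⟩
  𝟘                          ∎
  where open ≈-Reasoning

·-zeroʳ : ∀ q → q · 𝟘 ≈ 𝟘
·-zeroʳ q = x≈x⊕x⇒x≈𝟘 (≈-trans (·-cong (≈-sym (⊕-idˡ 𝟘))) (·-distˡ q 𝟘 𝟘))

·-comm : ∀ p q a → p · (q · a) ≈ q · (p · a)
·-comm p q a = begin
  p · (q · a)   ≈⟨ ·-assoc p q a ⟩
  (p *ℚ q) · a  ≡⟨ cong (_· a) (ℚ.*-comm p q) ⟩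
  (q *ℚ p) · a  ≈⟨ ·-assoc q p a ⟨
  q · (p · a)   ∎
  where open ≈-Reasoning

·-sum : ∀ {n} q (f : Fin n → Term) → q · sum f ≈ sum (λ i → q · f i)
·-sum {zero}  q f = ·-zeroʳ q
·-sum {suc n} q f = ≈-trans (·-distˡ q _ _) (⊕-cong ≈-refl (·-sum q (f ∘ fsuc)))

-1·[q·a]≈[-q]·a : ∀ q a → (- 1ℚ) · (q · a) ≈ (- q) · a
-1·[q·a]≈[-q]·a q a = begin
  (- 1ℚ) · (q · a)  ≈⟨ ·-assoc _ _ _ ⟩
  ((- 1ℚ) *ℚ q) · a ≡⟨ cong (_· a) (ℚ.neg-distribˡ-* 1ℚ q) ⟨
  (- (1ℚ *ℚ q)) · a ≡⟨ cong (λ r → (- r) · a) (ℚ.*-identityˡ q) ⟩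
  (- q) · a         ∎
  where open ≈-Reasoning

-- Signs of permutations

signPow-+ : ∀ a b → signPow (a + b) ≡ signPow a *ˢ signPow b
signPow-+ zero    b = refl
signPow-+ (suc a) b = trans (cong opposite (signPow-+ a b)) (sym (Sign.*-assoc ⁻ (signPow a) (signPow b)))

signPow-double : ∀ c → signPow (c + c) ≡ ⁺
signPow-double c = trans (signPow-+ c c) (Sign.s*s≡+ (signPow c))

*ˢ-opposite : ∀ a s → a *ˢ opposite s ≡ opposite (a *ˢ s)
*ˢ-opposite a s = solve 3 (λ a m s → a ⊛ (m ⊛ s) ⊜ m ⊛ (a ⊛ s)) refl a ⁻ s

negOnePow·gen : ∀ d {n} (X : SetSystem n) u → negOnePow d · gen X u ≈ gen X (signPow d *ˢ u)
negOnePow·gen zero    X u = ·-one _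
negOnePow·gen (suc d) X u = begin
  (- negOnePow d) · gen X u          ≈⟨ -1·[q·a]≈[-q]·a _ _ ⟨
  (- 1ℚ) · (negOnePow d · gen X u)   ≈⟨ ·-cong (negOnePow·gen d X u) ⟩
  (- 1ℚ) · gen X (signPow d *ˢ u)    ≈⟨ rel-sign X _ ⟨
  gen X (opposite (signPow d *ˢ u))  ≡⟨ cong (gen X) (Sign.*-assoc ⁻ (signPow d) u) ⟨
  gen X (opposite (signPow d) *ˢ u)  ∎
  where open ≈-Reasoning

module ℕ+ = CommutativeSemigroupProperties ℕ.+-commutativeSemigroup

iverson : Bool → ℕ
iverson b = if b then 1 else 0

inversion : ∀ {n} → (Fin n → Fin n) → Fin n → Fin n → ℕ
inversion f i j = iverson ((toℕ i <ᵇ toℕ j) ∧ (toℕ (f j) <ᵇ toℕ (f i)))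

open CommutativeMonoidSum ℕ.+-0-commutativeMonoid using (sum-syntax) renaming
  (sum to sumℕ; sum-cong-≗ to sumℕ-cong; sum-remove to sumℕ-remove; ∑-distrib-+ to sumℕ-distrib-+;
   sum-permute to sumℕ-permute; sum-replicate-zero to sumℕ-zero)

inversions≡sum : ∀ {n} (f : Fin n → Fin n) → inversions f ≡ ∑[ i < n ] ∑[ j < n ] inversion f i j
inversions≡sum {n} f = trans (foldr-map-allFin ℕ.+-0-monoid n _)
  (sumℕ-cong (λ i → foldr-map-allFin ℕ.+-0-monoid n (inversion f i)))

<ᵇ-irrefl : ∀ a → (a <ᵇ a) ≡ false
<ᵇ-irrefl zero    = refl
<ᵇ-irrefl (suc a) = <ᵇ-irrefl a

<ᵇ-asym : ∀ a b → (a <ᵇ b) ∧ (b <ᵇ a) ≡ false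
<ᵇ-asym zero    zero    = refl
<ᵇ-asym zero    (suc b) = refl
<ᵇ-asym (suc a) zero    = refl
<ᵇ-asym (suc a) (suc b) = <ᵇ-asym a b

sumℕ-zeros : ∀ {n} (f : Fin n → ℕ) → (∀ i → f i ≡ 0) → sumℕ f ≡ 0
sumℕ-zeros {n} f f≡0 = trans (sumℕ-cong f≡0) (sumℕ-zero n)

sgn-id : ∀ {n} → sgn (Perm.id {n}) ≡ ⁺
sgn-id {n} = cong signPow (trans (inversions≡sum {n} (λ k → k))
  (sumℕ-zeros {n} _ λ i → sumℕ-zeros {n} _ λ j → cong iverson (<ᵇ-asym (toℕ i) (toℕ j))))

punchIn-<ᵇ-punchIn : ∀ {n} (x : Fin (suc n)) (a b : Fin n) →
                     (toℕ (punchIn x a) <ᵇ toℕ (punchIn x b)) ≡ (toℕ a <ᵇ toℕ b)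
punchIn-<ᵇ-punchIn fzero    a        b        = refl
punchIn-<ᵇ-punchIn (fsuc x) fzero    fzero    = refl
punchIn-<ᵇ-punchIn (fsuc x) fzero    (fsuc b) = refl
punchIn-<ᵇ-punchIn (fsuc x) (fsuc a) fzero    = refl
punchIn-<ᵇ-punchIn (fsuc x) (fsuc a) (fsuc b) = punchIn-<ᵇ-punchIn x a b

punchIn-<ᵇ-pivot : ∀ {n} (x : Fin (suc n)) (j : Fin n) → (toℕ (punchIn x j) <ᵇ toℕ x) ≡ (toℕ j <ᵇ toℕ x)
punchIn-<ᵇ-pivot fzero    j        = refl
punchIn-<ᵇ-pivot (fsuc x) fzero    = refl
punchIn-<ᵇ-pivot (fsuc x) (fsuc j) = punchIn-<ᵇ-pivot x j

pivot-<ᵇ-punchIn : ∀ {n} (x : Fin (suc n)) (j : Fin n) → (toℕ x <ᵇ toℕ (punchIn x j)) ≡ not (toℕ j <ᵇ toℕ x)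
pivot-<ᵇ-punchIn fzero    j        = refl
pivot-<ᵇ-punchIn (fsuc x) fzero    = refl
pivot-<ᵇ-punchIn (fsuc x) (fsuc j) = pivot-<ᵇ-punchIn x j

sumℕ-iverson-<ᵇ : ∀ n y → y ≤ n → ∑[ k < n ] iverson (toℕ k <ᵇ y) ≡ y
sumℕ-iverson-<ᵇ n       zero    _         = sumℕ-zeros {n} _ (λ _ → refl)
sumℕ-iverson-<ᵇ (suc n) (suc y) (s≤s y≤n) = cong suc (sumℕ-iverson-<ᵇ n y y≤n)

iverson-splitˡ : ∀ a b → iverson (not a ∧ b) + iverson (a ∧ b) ≡ iverson b
iverson-splitˡ false b = ℕ.+-identityʳ (iverson b)
iverson-splitˡ true  b = refl

iverson-splitʳ : ∀ a b → iverson (a ∧ not b) + iverson (a ∧ b) ≡ iverson a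
iverson-splitʳ false b     = refl
iverson-splitʳ true  false = refl
iverson-splitʳ true  true  = refl

module _ {n} (σ : Permutation′ (suc n)) (x : Fin (suc n)) where
  private
    y = σ ⟨$⟩ʳ x
    σ′ = remove x σ

    before imageBefore : Fin n → Bool
    before j = toℕ j <ᵇ toℕ x
    imageBefore j = toℕ (σ′ ⟨$⟩ʳ j) <ᵇ toℕ y

    count : (Fin n → Bool) → ℕ
    count p = ∑[ j < n ] iverson (p j)

    -- A counts the inversions (x , j) of σ and B those (j , x); since A + C = toℕ y
    -- and B + C = toℕ x, their number A + B has the parity of toℕ x + toℕ y.
    A B C : ℕ
    A = count (λ j → not (before j) ∧ imageBefore j)
    B = count (λ j → before j ∧ not (imageBefore j))
    C = count (λ j → before j ∧ imageBefore j)

    A+C≡y : A + C ≡ toℕ y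
    A+C≡y = begin
      A + C                                           ≡⟨ sumℕ-distrib-+ {n} _ _ ⟨
      ∑[ j < n ] (iverson (not (before j) ∧ imageBefore j) + iverson (before j ∧ imageBefore j))
                                                      ≡⟨ sumℕ-cong {n} (λ j → iverson-splitˡ (before j) (imageBefore j)) ⟩
      count imageBefore                               ≡⟨ sumℕ-permute (λ k → iverson (toℕ k <ᵇ toℕ y)) σ′ ⟨
      ∑[ k < n ] iverson (toℕ k <ᵇ toℕ y)             ≡⟨ sumℕ-iverson-<ᵇ n (toℕ y) (Fin.toℕ≤pred[n] y) ⟩
      toℕ y                                           ∎
      where open ≡-Reasoning

    B+C≡x : B + C ≡ toℕ x
    B+C≡x = begin
      B + C                                           ≡⟨ sumℕ-distrib-+ {n} _ _ ⟨
      ∑[ j < n ] (iverson (before j ∧ not (imageBefore j)) + iverson (before j ∧ imageBefore j))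
                                                      ≡⟨ sumℕ-cong {n} (λ j → iverson-splitʳ (before j) (imageBefore j)) ⟩
      count before                                    ≡⟨ sumℕ-iverson-<ᵇ n (toℕ x) (Fin.toℕ≤pred[n] x) ⟩
      toℕ x                                           ∎
      where open ≡-Reasoning

    f f′ : Fin _ → Fin _
    f  = σ ⟨$⟩ʳ_
    f′ = σ′ ⟨$⟩ʳ_

    inversion-pivot-pivot : inversion f x x ≡ 0
    inversion-pivot-pivot = cong (λ a → iverson (a ∧ (toℕ y <ᵇ toℕ y))) (<ᵇ-irrefl (toℕ x))

    inversion-pivot-punchIn : ∀ j → inversion f x (punchIn x j) ≡ iverson (not (before j) ∧ imageBefore j)
    inversion-pivot-punchIn j = cong₂ (λ a b → iverson (a ∧ b)) (pivot-<ᵇ-punchIn x j)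
      (trans (cong (λ z → toℕ z <ᵇ toℕ y) (punchIn-permute σ x j)) (punchIn-<ᵇ-pivot y (f′ j)))

    inversion-punchIn-pivot : ∀ i → inversion f (punchIn x i) x ≡ iverson (before i ∧ not (imageBefore i))
    inversion-punchIn-pivot i = cong₂ (λ a b → iverson (a ∧ b)) (punchIn-<ᵇ-pivot x i)
      (trans (cong (λ z → toℕ y <ᵇ toℕ z) (punchIn-permute σ x i)) (pivot-<ᵇ-punchIn y (f′ i)))

    inversion-punchIn-punchIn : ∀ i j → inversion f (punchIn x i) (punchIn x j) ≡ inversion f′ i j
    inversion-punchIn-punchIn i j = cong₂ (λ a b → iverson (a ∧ b)) (punchIn-<ᵇ-punchIn x i j)
      (trans (cong₂ (λ a b → toℕ a <ᵇ toℕ b) (punchIn-permute σ x j) (punchIn-permute σ x i))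
             (punchIn-<ᵇ-punchIn y (f′ j) (f′ i)))

    inversions-remove : inversions f ≡ (A + B) + inversions f′
    inversions-remove = begin
      inversions f
        ≡⟨ inversions≡sum f ⟩
      ∑[ i < suc n ] ∑[ j < suc n ] inversion f i j
        ≡⟨ sumℕ-remove {i = x} (λ i → ∑[ j < suc n ] inversion f i j) ⟩
      ∑[ j < suc n ] inversion f x j + ∑[ i < n ] ∑[ j < suc n ] inversion f (punchIn x i) j
        ≡⟨ cong₂ _+_ (sumℕ-remove {i = x} (inversion f x))
                     (sumℕ-cong {n} (λ i → sumℕ-remove {i = x} (inversion f (punchIn x i)))) ⟩
      (inversion f x x + ∑[ j < n ] inversion f x (punchIn x j))
        + ∑[ i < n ] (inversion f (punchIn x i) x + ∑[ j < n ] inversion f (punchIn x i) (punchIn x j))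
        ≡⟨ cong₂ _+_ (cong₂ _+_ inversion-pivot-pivot (sumℕ-cong {n} inversion-pivot-punchIn))
                     (sumℕ-distrib-+ {n} _ _) ⟩
      A + (∑[ i < n ] inversion f (punchIn x i) x + ∑[ i < n ] ∑[ j < n ] inversion f (punchIn x i) (punchIn x j))
        ≡⟨ cong (A +_) (cong₂ _+_ (sumℕ-cong {n} inversion-punchIn-pivot)
                                  (sumℕ-cong {n} (λ i → sumℕ-cong {n} (inversion-punchIn-punchIn i)))) ⟩
      A + (B + ∑[ i < n ] ∑[ j < n ] inversion f′ i j)
        ≡⟨ ℕ.+-assoc A B _ ⟨
      (A + B) + ∑[ i < n ] ∑[ j < n ] inversion f′ i j
        ≡⟨ cong (A + B +_) (inversions≡sum f′) ⟨
      (A + B) + inversions f′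
        ∎
      where open ≡-Reasoning

    A+B≡x+y-mod-2 : signPow (A + B) ≡ signPow (toℕ x + toℕ y)
    A+B≡x+y-mod-2 = begin
      signPow (A + B)                           ≡⟨ Sign.*-identityʳ _ ⟨
      signPow (A + B) *ˢ ⁺                      ≡⟨ cong (signPow (A + B) *ˢ_) (signPow-double C) ⟨
      signPow (A + B) *ˢ signPow (C + C)        ≡⟨ signPow-+ (A + B) (C + C) ⟨
      signPow ((A + B) + (C + C))               ≡⟨ cong signPow (ℕ+.interchange A B C C) ⟩
      signPow ((A + C) + (B + C))               ≡⟨ cong signPow (cong₂ _+_ A+C≡y B+C≡x) ⟩
      signPow (toℕ y + toℕ x)                   ≡⟨ cong signPow (ℕ.+-comm (toℕ y) (toℕ x)) ⟩
      signPow (toℕ x + toℕ y)                   ∎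
      where open ≡-Reasoning

  sgn-remove : sgn σ ≡ signPow (toℕ x + toℕ (σ ⟨$⟩ʳ x)) *ˢ sgn (remove x σ)
  sgn-remove = begin
    sgn σ                                  ≡⟨ cong signPow inversions-remove ⟩
    signPow ((A + B) + inversions f′)      ≡⟨ signPow-+ (A + B) _ ⟩
    signPow (A + B) *ˢ sgn σ′              ≡⟨ cong (_*ˢ sgn σ′) A+B≡x+y-mod-2 ⟩
    signPow (toℕ x + toℕ y) *ˢ sgn σ′      ∎
    where open ≡-Reasoning

module _ {m n : ℕ} where

  blockMap : (Fin m → Fin m) → (Fin n → Fin n) → Fin (m + n) → Fin (m + n)
  blockMap f g = join m n ∘ Sum.map f g ∘ splitAt m

  blockMap-↑ˡ : ∀ f g (i : Fin m) → blockMap f g (i ↑ˡ n) ≡ f i ↑ˡ n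
  blockMap-↑ˡ f g i = cong (join m n ∘ Sum.map f g) (Fin.splitAt-↑ˡ m i n)

  blockMap-↑ʳ : ∀ f g (j : Fin n) → blockMap f g (m ↑ʳ j) ≡ m ↑ʳ g j
  blockMap-↑ʳ f g j = cong (join m n ∘ Sum.map f g) (Fin.splitAt-↑ʳ m n j)

  blockMap-inverse : ∀ {f f′ g g′} → (∀ i → f (f′ i) ≡ i) → (∀ j → g (g′ j) ≡ j) →
                     ∀ k → blockMap f g (blockMap f′ g′ k) ≡ k
  blockMap-inverse {f} {f′} {g} {g′} ff′ gg′ k = begin
    join m n (Sum.map f g (splitAt m (join m n (Sum.map f′ g′ (splitAt m k)))))
      ≡⟨ cong (join m n ∘ Sum.map f g) (Fin.splitAt-join m n (Sum.map f′ g′ (splitAt m k))) ⟩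
    join m n (Sum.map f g (Sum.map f′ g′ (splitAt m k)))
      ≡⟨ cong (join m n) (Sum.map-map (splitAt m k)) ⟩
    join m n (Sum.map (f ∘ f′) (g ∘ g′) (splitAt m k))
      ≡⟨ cong (join m n) (trans (Sum.map-cong ff′ gg′ (splitAt m k)) (Sum.map-id (splitAt m k))) ⟩
    join m n (splitAt m k)
      ≡⟨ Fin.join-splitAt m n k ⟩
    k ∎
    where open ≡-Reasoning

infixr 5 _⊕ₚ_
_⊕ₚ_ : ∀ {m n} → Permutation′ m → Permutation′ n → Permutation′ (m + n)
ψ ⊕ₚ φ = permutation (blockMap (ψ ⟨$⟩ʳ_) (φ ⟨$⟩ʳ_)) (blockMap (ψ ⟨$⟩ˡ_) (φ ⟨$⟩ˡ_))
  (blockMap-inverse (λ _ → Perm.inverseʳ ψ) (λ _ → Perm.inverseʳ φ))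
  (blockMap-inverse (λ _ → Perm.inverseˡ ψ) (λ _ → Perm.inverseˡ φ))

↑ˡ-<ᵇ-↑ˡ : ∀ {m} n (a b : Fin m) → (toℕ (a ↑ˡ n) <ᵇ toℕ (b ↑ˡ n)) ≡ (toℕ a <ᵇ toℕ b)
↑ˡ-<ᵇ-↑ˡ n a b = cong₂ _<ᵇ_ (Fin.toℕ-↑ˡ a n) (Fin.toℕ-↑ˡ b n)

↑ʳ-<ᵇ-↑ʳ : ∀ m {n} (a b : Fin n) → (toℕ (m ↑ʳ a) <ᵇ toℕ (m ↑ʳ b)) ≡ (toℕ a <ᵇ toℕ b)
↑ʳ-<ᵇ-↑ʳ zero    a b = refl
↑ʳ-<ᵇ-↑ʳ (suc m) a b = ↑ʳ-<ᵇ-↑ʳ m a b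

↑ˡ-<ᵇ-↑ʳ : ∀ {m n} (a : Fin m) (b : Fin n) → (toℕ (a ↑ˡ n) <ᵇ toℕ (m ↑ʳ b)) ≡ true
↑ˡ-<ᵇ-↑ʳ fzero    b = refl
↑ˡ-<ᵇ-↑ʳ (fsuc a) b = ↑ˡ-<ᵇ-↑ʳ a b

↑ʳ-<ᵇ-↑ˡ : ∀ {m n} (a : Fin m) (b : Fin n) → (toℕ (m ↑ʳ b) <ᵇ toℕ (a ↑ˡ n)) ≡ false
↑ʳ-<ᵇ-↑ˡ fzero    b = refl
↑ʳ-<ᵇ-↑ˡ (fsuc a) b = ↑ʳ-<ᵇ-↑ˡ a b

module _ {m n} (ψ : Permutation′ m) (φ : Permutation′ n) where
  private
    f = (ψ ⊕ₚ φ) ⟨$⟩ʳ_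
    ψʳ = ψ ⟨$⟩ʳ_
    φʳ = φ ⟨$⟩ʳ_

    inversion-↑ˡ-↑ˡ : ∀ i i′ → inversion f (i ↑ˡ n) (i′ ↑ˡ n) ≡ inversion ψʳ i i′
    inversion-↑ˡ-↑ˡ i i′ = cong₂ (λ a b → iverson (a ∧ b)) (↑ˡ-<ᵇ-↑ˡ n i i′)
      (trans (cong₂ (λ a b → toℕ a <ᵇ toℕ b) (blockMap-↑ˡ ψʳ φʳ i′) (blockMap-↑ˡ ψʳ φʳ i))
             (↑ˡ-<ᵇ-↑ˡ n (ψʳ i′) (ψʳ i)))

    inversion-↑ʳ-↑ʳ : ∀ j j′ → inversion f (m ↑ʳ j) (m ↑ʳ j′) ≡ inversion φʳ j j′
    inversion-↑ʳ-↑ʳ j j′ = cong₂ (λ a b → iverson (a ∧ b)) (↑ʳ-<ᵇ-↑ʳ m j j′)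
      (trans (cong₂ (λ a b → toℕ a <ᵇ toℕ b) (blockMap-↑ʳ ψʳ φʳ j′) (blockMap-↑ʳ ψʳ φʳ j))
             (↑ʳ-<ᵇ-↑ʳ m (φʳ j′) (φʳ j)))

    inversion-↑ˡ-↑ʳ : ∀ i j → inversion f (i ↑ˡ n) (m ↑ʳ j) ≡ 0
    inversion-↑ˡ-↑ʳ i j = cong₂ (λ a b → iverson (a ∧ b)) (↑ˡ-<ᵇ-↑ʳ i j)
      (trans (cong₂ (λ a b → toℕ a <ᵇ toℕ b) (blockMap-↑ʳ ψʳ φʳ j) (blockMap-↑ˡ ψʳ φʳ i))
             (↑ʳ-<ᵇ-↑ˡ (ψʳ i) (φʳ j)))

    inversion-↑ʳ-↑ˡ : ∀ j i → inversion f (m ↑ʳ j) (i ↑ˡ n) ≡ 0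
    inversion-↑ʳ-↑ˡ j i = cong (λ a → iverson (a ∧ (toℕ (f (i ↑ˡ n)) <ᵇ toℕ (f (m ↑ʳ j))))) (↑ʳ-<ᵇ-↑ˡ i j)

    sumℕ-↑ : ∀ (g : Fin (m + n) → ℕ) → ∑[ k < m + n ] g k ≡ ∑[ i < m ] g (i ↑ˡ n) + ∑[ j < n ] g (m ↑ʳ j)
    sumℕ-↑ = sum-↑ ℕ.+-0-monoid m

  inversions-⊕ₚ : inversions ((ψ ⊕ₚ φ) ⟨$⟩ʳ_) ≡ inversions (ψ ⟨$⟩ʳ_) + inversions (φ ⟨$⟩ʳ_)
  inversions-⊕ₚ = begin
    inversions f
      ≡⟨ inversions≡sum f ⟩
    ∑[ k < m + n ] ∑[ l < m + n ] inversion f k l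
      ≡⟨ trans (sumℕ-↑ _) (cong₂ _+_ (sumℕ-cong {m} (λ i → sumℕ-↑ _)) (sumℕ-cong {n} (λ j → sumℕ-↑ _))) ⟩
    ∑[ i < m ] (∑[ i′ < m ] inversion f (i ↑ˡ n) (i′ ↑ˡ n) + ∑[ j < n ] inversion f (i ↑ˡ n) (m ↑ʳ j))
      + ∑[ j < n ] (∑[ i < m ] inversion f (m ↑ʳ j) (i ↑ˡ n) + ∑[ j′ < n ] inversion f (m ↑ʳ j) (m ↑ʳ j′))
      ≡⟨ cong₂ _+_
           (sumℕ-cong {m} λ i → cong₂ _+_ (sumℕ-cong {m} (inversion-↑ˡ-↑ˡ i)) (sumℕ-zeros {n} _ (inversion-↑ˡ-↑ʳ i)))
           (sumℕ-cong {n} λ j → cong₂ _+_ (sumℕ-zeros {m} _ (inversion-↑ʳ-↑ˡ j)) (sumℕ-cong {n} (inversion-↑ʳ-↑ʳ j))) ⟩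
    ∑[ i < m ] (∑[ i′ < m ] inversion ψʳ i i′ + 0) + ∑[ j < n ] ∑[ j′ < n ] inversion φʳ j j′
      ≡⟨ cong₂ _+_ (trans (sumℕ-cong {m} (λ i → ℕ.+-identityʳ _)) (sym (inversions≡sum ψʳ)))
                   (sym (inversions≡sum φʳ)) ⟩
    inversions ψʳ + inversions φʳ
      ∎
    where open ≡-Reasoning

  sgn-⊕ₚ : sgn (ψ ⊕ₚ φ) ≡ sgn ψ *ˢ sgn φ
  sgn-⊕ₚ = trans (cong signPow inversions-⊕ₚ) (signPow-+ (inversions (ψ ⟨$⟩ʳ_)) (inversions (φ ⟨$⟩ʳ_)))

lookup-extensionality : ∀ {A : Set} {n} {u v : Vec A n} → (∀ i → lookup u i ≡ lookup v i) → u ≡ v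
lookup-extensionality {u = u} {v} u≗v =
  trans (sym (Vec.tabulate∘lookup u)) (trans (Vec.tabulate-cong u≗v) (Vec.tabulate∘lookup v))

lookup-take : ∀ {A : Set} m {n} (V : Vec A (m + n)) i → lookup (take m V) i ≡ lookup V (i ↑ˡ n)
lookup-take m V i = trans (sym (Vec.lookup-++ˡ (take m V) (drop m V) i))
                          (cong (λ V → lookup V (i ↑ˡ _)) (Vec.take++drop≡id m V))

lookup-drop : ∀ {A : Set} m {n} (V : Vec A (m + n)) j → lookup (drop m V) j ≡ lookup V (m ↑ʳ j)
lookup-drop m V j = trans (sym (Vec.lookup-++ʳ (take m V) (drop m V) j))
                          (cong (λ V → lookup V (m ↑ʳ j)) (Vec.take++drop≡id m V))

module _ {A : Set} {m n} (U : Vec A m) (V : Vec A n) where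

  take-++ : take m (U ++ V) ≡ U
  take-++ = Vec.++-injectiveˡ (take m (U ++ V)) U (Vec.take++drop≡id m (U ++ V))

  drop-++ : drop m (U ++ V) ≡ V
  drop-++ = Vec.++-injectiveʳ (take m (U ++ V)) U (Vec.take++drop≡id m (U ++ V))

∈-take-drop : ∀ m {n} {k} {B : Subset (m + n)} → k ∈ take m B ++ drop m B → k ∈ B
∈-take-drop m {k = k} {B} = subst (k ∈_) (Vec.take++drop≡id m B)

insertAt-≡ : ∀ {A : Set} {n} {U : Vec A n} {V : Vec A (suc n)} y {v} →
             lookup V y ≡ v → (∀ j → lookup V (punchIn y j) ≡ lookup U j) → insertAt U y v ≡ V
insertAt-≡ {U = U} {V} y {v} Vy≡v V∘punchIn≡U = lookup-extensionality pointwise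
  where
  pointwise : ∀ k → lookup (insertAt U y v) k ≡ lookup V k
  pointwise k with k Fin.≟ y
  ... | yes refl = trans (Vec.insertAt-lookup U y v) (sym Vy≡v)
  ... | no k≢y   = subst (λ k → lookup (insertAt U y v) k ≡ lookup V k) (Fin.punchIn-punchOut y≢k)
                     (trans (Vec.insertAt-punchIn U y v (punchOut y≢k)) (sym (V∘punchIn≡U _)))
    where y≢k = k≢y ∘ sym

module _ {A : Set} where

  take-insertAt-↑ˡ : ∀ {m n} (S : Vec A (m + n)) (i : Fin (suc m)) v →
                     take (suc m) (insertAt S (i ↑ˡ n) v) ≡ insertAt (take m S) i v
  take-insertAt-↑ˡ         S       fzero    v = refl
  take-insertAt-↑ˡ {suc m} (x ∷ S) (fsuc i) v = cong (x ∷_) (take-insertAt-↑ˡ S i v)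

  drop-insertAt-↑ˡ : ∀ {m n} (S : Vec A (m + n)) (i : Fin (suc m)) v →
                     drop (suc m) (insertAt S (i ↑ˡ n) v) ≡ drop m S
  drop-insertAt-↑ˡ         S       fzero    v = refl
  drop-insertAt-↑ˡ {suc m} (x ∷ S) (fsuc i) v = drop-insertAt-↑ˡ S i v

  take-insertAt-↑ʳ : ∀ m {n} (S : Vec A (m + suc n)) (j : Fin (suc n)) v .(p : m + suc n ≡ suc m + n) →
                     take (suc m) (insertAt S (suc m ↑ʳ j) v) ≡ take (suc m) (cast p S)
  take-insertAt-↑ʳ zero    (x ∷ S) j v p = refl
  take-insertAt-↑ʳ (suc m) (x ∷ S) j v p = cong (x ∷_) (take-insertAt-↑ʳ m S j v (ℕ.suc-injective p))

  drop-insertAt-↑ʳ : ∀ m {n} (S : Vec A (m + suc n)) (j : Fin (suc n)) v .(p : m + suc n ≡ suc m + n) →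
                     drop (suc m) (insertAt S (suc m ↑ʳ j) v) ≡ insertAt (drop (suc m) (cast p S)) j v
  drop-insertAt-↑ʳ zero    (x ∷ S) j v p = cong (λ S → insertAt S j v) (sym (cast-is-id _ S))
  drop-insertAt-↑ʳ (suc m) (x ∷ S) j v p = drop-insertAt-↑ʳ m S j v (ℕ.suc-injective p)

++⁺-⊆ : ∀ {m n} {U U′ : Subset m} {V V′ : Subset n} → U ⊆ U′ → V ⊆ V′ → U ++ V ⊆ U′ ++ V′
++⁺-⊆ {U = []}    {[]}      _    V⊆V′ k∈ = V⊆V′ k∈
++⁺-⊆ {U = _ ∷ _} {_ ∷ _} U⊆U′ _    here with U⊆U′ here
... | here = here
++⁺-⊆ {U = _ ∷ _} {_ ∷ _} U⊆U′ V⊆V′ (there k∈) = there (++⁺-⊆ (Subset.drop-∷-⊆ U⊆U′) V⊆V′ k∈)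

++⁻-⊆ˡ : ∀ {m n} {U U′ : Subset m} {V V′ : Subset n} → U ++ V ⊆ U′ ++ V′ → U ⊆ U′
++⁻-⊆ˡ {U = _ ∷ _} {_ ∷ _} UV⊆ here with UV⊆ here
... | here = here
++⁻-⊆ˡ {U = _ ∷ _} {_ ∷ _} UV⊆ (there k∈) = there (++⁻-⊆ˡ (Subset.drop-∷-⊆ UV⊆) k∈)

++⁻-⊆ʳ : ∀ {m n} {U U′ : Subset m} {V V′ : Subset n} → U ++ V ⊆ U′ ++ V′ → V ⊆ V′
++⁻-⊆ʳ {U = []}    {[]}    UV⊆ = UV⊆
++⁻-⊆ʳ {U = _ ∷ U} {_ ∷ U′} UV⊆ = ++⁻-⊆ʳ {U = U} {U′} (Subset.drop-∷-⊆ UV⊆)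

module _ {m n} {U : Subset m} {V : Subset n} where

  ∈-++⁺ˡ : ∀ {i} → i ∈ U → i ↑ˡ n ∈ U ++ V
  ∈-++⁺ˡ {i} i∈U = Vec.lookup⇒[]= (i ↑ˡ n) (U ++ V) (trans (Vec.lookup-++ˡ U V i) (Vec.[]=⇒lookup i∈U))

  ∈-++⁻ˡ : ∀ {i} → i ↑ˡ n ∈ U ++ V → i ∈ U
  ∈-++⁻ˡ {i} i∈UV = Vec.lookup⇒[]= i U (trans (sym (Vec.lookup-++ˡ U V i)) (Vec.[]=⇒lookup i∈UV))

  ∈-++⁺ʳ : ∀ {j} → j ∈ V → m ↑ʳ j ∈ U ++ V
  ∈-++⁺ʳ {j} j∈V = Vec.lookup⇒[]= (m ↑ʳ j) (U ++ V) (trans (Vec.lookup-++ʳ U V j) (Vec.[]=⇒lookup j∈V))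

  ∈-++⁻ʳ : ∀ {j} → m ↑ʳ j ∈ U ++ V → j ∈ V
  ∈-++⁻ʳ {j} j∈UV = Vec.lookup⇒[]= j V (trans (sym (Vec.lookup-++ʳ U V j)) (Vec.[]=⇒lookup j∈UV))

∅-++ : ∀ m {n} → ∅ {m + n} ≡ ∅ {m} ++ ∅ {n}
∅-++ zero    = refl
∅-++ (suc m) = cong (outside ∷_) (∅-++ m)

⁅↑ˡ⁆ : ∀ {m} n (i : Fin m) → ⁅ i ↑ˡ n ⁆ ≡ ⁅ i ⁆ ++ ∅
⁅↑ˡ⁆ {suc m} n fzero    = cong (inside ∷_) (∅-++ m)
⁅↑ˡ⁆         n (fsuc i) = cong (outside ∷_) (⁅↑ˡ⁆ n i)

⁅↑ʳ⁆ : ∀ m {n} (j : Fin n) → ⁅ m ↑ʳ j ⁆ ≡ ∅ ++ ⁅ j ⁆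
⁅↑ʳ⁆ zero    j = refl
⁅↑ʳ⁆ (suc m) j = cong (outside ∷_) (⁅↑ʳ⁆ m j)

⊆-⊄⇒≡ : ∀ {n} {p q : Subset n} → p ⊆ q → ¬ (p ⊂ q) → p ≡ q
⊆-⊄⇒≡ {p = []}          {[]}          _   _   = refl
⊆-⊄⇒≡ {p = outside ∷ p} {outside ∷ q} p⊆q p⊄q = cong (outside ∷_) (⊆-⊄⇒≡ (Subset.drop-∷-⊆ p⊆q) (p⊄q ∘ Subset.s⊂s))
⊆-⊄⇒≡ {p = outside ∷ p} {inside  ∷ q} p⊆q p⊄q = ⊥-elim (p⊄q (Subset.out⊂in (Subset.drop-∷-⊆ p⊆q)))
⊆-⊄⇒≡ {p = inside  ∷ p} {outside ∷ q} p⊆q p⊄q with p⊆q here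
... | ()
⊆-⊄⇒≡ {p = inside  ∷ p} {inside  ∷ q} p⊆q p⊄q = cong (inside ∷_) (⊆-⊄⇒≡ (Subset.drop-∷-⊆ p⊆q) (p⊄q ∘ Subset.s⊂s))

∧≡true⁻ : ∀ {a b} → a ∧ b ≡ true → a ≡ true × b ≡ true
∧≡true⁻ {true} {true} refl = refl , refl

-- Images and isomorphisms

module _ {n} (σ : Permutation′ n) where

  lookup-image : ∀ S k → lookup (image σ S) k ≡ lookup S (σ ⟨$⟩ˡ k)
  lookup-image S = Vec.lookup∘tabulate _

  ∈-image⁺ : ∀ {S k} → σ ⟨$⟩ˡ k ∈ S → k ∈ image σ S
  ∈-image⁺ {S} {k} σ⁻¹k∈S = Vec.lookup⇒[]= k _ (trans (lookup-image S k) (Vec.[]=⇒lookup σ⁻¹k∈S))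

  ∈-image⁻ : ∀ {S k} → k ∈ image σ S → σ ⟨$⟩ˡ k ∈ S
  ∈-image⁻ {S} {k} k∈σS = Vec.lookup⇒[]= _ S (trans (sym (lookup-image S k)) (Vec.[]=⇒lookup k∈σS))

  image-⁅⁆ : ∀ x → image σ ⁅ x ⁆ ≡ ⁅ σ ⟨$⟩ʳ x ⁆
  image-⁅⁆ x = Subset.⊆-antisym
    (λ k∈ → subst (_∈ ⁅ σ ⟨$⟩ʳ x ⁆)
                  (trans (cong (σ ⟨$⟩ʳ_) (sym (Subset.x∈⁅y⁆⇒x≡y x (∈-image⁻ k∈)))) (Perm.inverseʳ σ))
                  (Subset.x∈⁅x⁆ _))
    (λ k∈ → ∈-image⁺ (subst (_∈ ⁅ x ⁆)
                            (sym (trans (cong (σ ⟨$⟩ˡ_) (Subset.x∈⁅y⁆⇒x≡y _ k∈)) (Perm.inverseˡ σ)))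
                            (Subset.x∈⁅x⁆ x)))

image-id : ∀ {n} (S : Subset n) → image Perm.id S ≡ S
image-id S = Vec.tabulate∘lookup S

image-flip : ∀ {n} (σ : Permutation′ n) S → image σ (image (Perm.flip σ) S) ≡ S
image-flip σ S = lookup-extensionality λ k →
  trans (lookup-image σ (image (Perm.flip σ) S) k)
        (trans (lookup-image (Perm.flip σ) S _) (cong (lookup S) (Perm.inverseʳ σ)))

Iso-sym : ∀ {n} {M M′ : SetSystem n} → Iso M M′ → Iso M′ M
Iso-sym {M′ = M′} ψ = record
  { perm = Perm.flip (perm ψ)
  ; pres = λ S → trans (sym (pres ψ _)) (cong (indep M′) (image-flip (perm ψ) S))
  }

Iso-refl : ∀ {n} (M : SetSystem n) → Iso M M
Iso-refl M = record { perm = Perm.id ; pres = λ S → cong (indep M) (image-id S) }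

module _ {n} {M M′ : SetSystem n} (ψ : Iso M M′) where
  private
    σ = perm ψ

  Iso-isBasis : ∀ {B} → IsBasis M B → IsBasis M′ (image σ B)
  Iso-isBasis {B} (indB , maximalB) = trans (pres ψ B) indB , λ T′ σB⊆T′ indT′ →
    let T = image (Perm.flip σ) T′
        B⊆T : B ⊆ T
        B⊆T x∈B = ∈-image⁺ (Perm.flip σ) (σB⊆T′ (∈-image⁺ σ (subst (_∈ B) (sym (Perm.inverseˡ σ)) x∈B)))
        indT : indep M T ≡ true
        indT = trans (sym (pres ψ T)) (trans (cong (indep M′) (image-flip σ T′)) indT′)
    in trans (sym (image-flip σ T′)) (cong (image σ) (maximalB T B⊆T indT))

  Iso-indep-⁅⁆ : ∀ x → indep M′ ⁅ σ ⟨$⟩ʳ x ⁆ ≡ indep M ⁅ x ⁆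
  Iso-indep-⁅⁆ x = trans (cong (indep M′) (sym (image-⁅⁆ σ x))) (pres ψ ⁅ x ⁆)

Iso-isColoop : ∀ {n} {M M′ : SetSystem n} (ψ : Iso M M′) {x} → IsColoop M x → IsColoop M′ (perm ψ ⟨$⟩ʳ x)
Iso-isColoop ψ coloop B′ basisB′ = ∈-image⁻ (Perm.flip (perm ψ)) (coloop _ (Iso-isBasis (Iso-sym ψ) basisB′))

Iso-isColoop⇔ : ∀ {n} {M M′ : SetSystem n} (ψ : Iso M M′) x → IsColoop M x ⇔ IsColoop M′ (perm ψ ⟨$⟩ʳ x)
Iso-isColoop⇔ {M = M} ψ x = mk⇔ (Iso-isColoop ψ)
  (λ coloop → subst (IsColoop M) (Perm.inverseˡ (perm ψ)) (Iso-isColoop (Iso-sym ψ) coloop))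

module _ {m n} (ψ : Permutation′ m) (φ : Permutation′ n) (S : Subset (m + n)) where

  take-image-⊕ₚ : take m (image (ψ ⊕ₚ φ) S) ≡ image ψ (take m S)
  take-image-⊕ₚ = lookup-extensionality λ i → begin
    lookup (take m (image (ψ ⊕ₚ φ) S)) i     ≡⟨ lookup-take m _ i ⟩
    lookup (image (ψ ⊕ₚ φ) S) (i ↑ˡ n)       ≡⟨ lookup-image (ψ ⊕ₚ φ) S _ ⟩
    lookup S ((ψ ⊕ₚ φ) ⟨$⟩ˡ (i ↑ˡ n))        ≡⟨ cong (lookup S) (blockMap-↑ˡ (ψ ⟨$⟩ˡ_) (φ ⟨$⟩ˡ_) i) ⟩
    lookup S ((ψ ⟨$⟩ˡ i) ↑ˡ n)               ≡⟨ lookup-take m S _ ⟨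
    lookup (take m S) (ψ ⟨$⟩ˡ i)             ≡⟨ lookup-image ψ (take m S) i ⟨
    lookup (image ψ (take m S)) i            ∎
    where open ≡-Reasoning

  drop-image-⊕ₚ : drop m (image (ψ ⊕ₚ φ) S) ≡ image φ (drop m S)
  drop-image-⊕ₚ = lookup-extensionality λ j → begin
    lookup (drop m (image (ψ ⊕ₚ φ) S)) j     ≡⟨ lookup-drop m _ j ⟩
    lookup (image (ψ ⊕ₚ φ) S) (m ↑ʳ j)       ≡⟨ lookup-image (ψ ⊕ₚ φ) S _ ⟩
    lookup S ((ψ ⊕ₚ φ) ⟨$⟩ˡ (m ↑ʳ j))        ≡⟨ cong (lookup S) (blockMap-↑ʳ (ψ ⟨$⟩ˡ_) (φ ⟨$⟩ˡ_) j) ⟩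
    lookup S (m ↑ʳ (φ ⟨$⟩ˡ j))               ≡⟨ lookup-drop m S _ ⟨
    lookup (drop m S) (φ ⟨$⟩ˡ j)             ≡⟨ lookup-image φ (drop m S) j ⟨
    lookup (image φ (drop m S)) j            ∎
    where open ≡-Reasoning

Iso-⊕ₘ : ∀ {m n} {M M′ : SetSystem m} {Q Q′ : SetSystem n} → Iso M M′ → Iso Q Q′ → Iso (M ⊕ₘ Q) (M′ ⊕ₘ Q′)
Iso-⊕ₘ {M′ = M′} {Q′ = Q′} ψ φ = record
  { perm = perm ψ ⊕ₚ perm φ
  ; pres = λ S → cong₂ _∧_
      (trans (cong (indep M′) (take-image-⊕ₚ (perm ψ) (perm φ) S)) (pres ψ _))
      (trans (cong (indep Q′) (drop-image-⊕ₚ (perm ψ) (perm φ) S)) (pres φ _))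
  }

gen-cong : ∀ {n} {X Y : SetSystem n} u → (∀ S → indep X S ≡ indep Y S) → gen X u ≈ gen Y u
gen-cong {n} {X} {Y} u X≗Y = ≈-trans (rel-iso X≅Y u) (≈-reflexive (cong (λ s → gen Y (s *ˢ u)) (sgn-id {n})))
  where
  X≅Y : Iso X Y
  X≅Y = record { perm = Perm.id ; pres = λ S → trans (cong (indep Y) (image-id S)) (sym (X≗Y S)) }

gen-cast : ∀ {k k′} (p : k ≡ k′) {X : SetSystem k} {Y : SetSystem k′} u →
           (∀ S → indep X S ≡ indep Y (cast p S)) → gen X u ≈ gen Y u
gen-cast refl {Y = Y} u X≗Y = gen-cong u (λ S → trans (X≗Y S) (cong (indep Y) (cast-is-id refl S)))

-- Minors, and the well-definedness of ∂ and ⋆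

insertedValue : Which → ∀ {k} → SetSystem (suc k) → Fin (suc k) → Bool
insertedValue del X x = false
insertedValue clp X x = false
insertedValue con X x = not (does (isLoop? X x))
insertedValue lp  X x = not (does (isLoop? X x))

minor-indep : ∀ w {k} (X : SetSystem (suc k)) x S → indep (minor w X x) S ≡ indep X (insertAt S x (insertedValue w X x))
minor-indep del X x S = refl
minor-indep clp X x S = refl
minor-indep con X x S = refl
minor-indep lp  X x S = refl

module _ {k k′} {X : SetSystem (suc k)} {Y : SetSystem (suc k′)} {x y}
         (X⁅x⁆≡Y⁅y⁆ : indep X ⁅ x ⁆ ≡ indep Y ⁅ y ⁆) where

  private
    isLoop-≡ : does (isLoop? X x) ≡ does (isLoop? Y y)
    isLoop-≡ = cong (λ b → does (b Bool.≟ false)) X⁅x⁆≡Y⁅y⁆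

  insertedValue-≡ : ∀ w → insertedValue w X x ≡ insertedValue w Y y
  insertedValue-≡ del = refl
  insertedValue-≡ clp = refl
  insertedValue-≡ con = cong not isLoop-≡
  insertedValue-≡ lp  = cong not isLoop-≡

  select-≡ : ∀ w → (IsColoop X x ⇔ IsColoop Y y) → select w X x ≡ select w Y y
  select-≡ del coloop⇔ = cong not (does-⇔ coloop⇔ (isColoop? X x) (isColoop? Y y))
  select-≡ clp coloop⇔ = does-⇔ coloop⇔ (isColoop? X x) (isColoop? Y y)
  select-≡ con _       = cong not isLoop-≡
  select-≡ lp  _       = isLoop-≡

∂term : Which → ∀ {k} → SetSystem k → Sign → Fin k → Term
∂term w {suc k} M s x = if select w M x then gen (minor w M x) (signPow (toℕ x) *ˢ s) else 𝟘

∂gen≡sum : ∀ w {k} (M : SetSystem k) s → ∂gen w M s ≡ sum (∂term w M s)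
∂gen≡sum w {zero}  M s = refl
∂gen≡sum w {suc k} M s = foldr-map-allFin (CommutativeMonoid.monoid ⊕-𝟘-commutativeMonoid) (suc k) _

if-𝟘-cong : ∀ {b b′} {a a′ : Term} → b ≡ b′ → (b ≡ true → a ≈ a′) → (if b then a else 𝟘) ≈ (if b′ then a′ else 𝟘)
if-𝟘-cong {true}  refl a≈a′ = a≈a′ refl
if-𝟘-cong {false} refl _    = ≈-refl

if-𝟘-map : ∀ (f : Term → Term) → f 𝟘 ≈ 𝟘 → ∀ b {a} → f (if b then a else 𝟘) ≈ (if b then f a else 𝟘)
if-𝟘-map f f𝟘≈𝟘 true  = ≈-refl
if-𝟘-map f f𝟘≈𝟘 false = f𝟘≈𝟘

module _ {n} {M M′ : SetSystem (suc n)} (ψ : Iso M M′) (x : Fin (suc n)) where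
  private
    σ = perm ψ
    σ′ = remove x σ
    y = σ ⟨$⟩ʳ x

  insertAt-image : ∀ S v → insertAt (image σ′ S) y v ≡ image σ (insertAt S x v)
  insertAt-image S v = insertAt-≡ y
    (trans (lookup-image σ (insertAt S x v) y)
           (trans (cong (lookup (insertAt S x v)) (Perm.inverseˡ σ)) (Vec.insertAt-lookup S x v)))
    (λ j → trans (lookup-image σ (insertAt S x v) (punchIn y j))
          (trans (cong (lookup (insertAt S x v)) (σ⁻¹∘punchIn j))
          (trans (Vec.insertAt-punchIn S x v _) (sym (lookup-image σ′ S j)))))
    where
    σ⁻¹∘punchIn : ∀ j → σ ⟨$⟩ˡ punchIn y j ≡ punchIn x (σ′ ⟨$⟩ˡ j)
    σ⁻¹∘punchIn j = begin
      σ ⟨$⟩ˡ punchIn y j                          ≡⟨ cong (λ j → σ ⟨$⟩ˡ punchIn y j) (Perm.inverseʳ σ′) ⟨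
      σ ⟨$⟩ˡ punchIn y (σ′ ⟨$⟩ʳ (σ′ ⟨$⟩ˡ j))      ≡⟨ cong (σ ⟨$⟩ˡ_) (punchIn-permute σ x _) ⟨
      σ ⟨$⟩ˡ (σ ⟨$⟩ʳ punchIn x (σ′ ⟨$⟩ˡ j))       ≡⟨ Perm.inverseˡ σ ⟩
      punchIn x (σ′ ⟨$⟩ˡ j)                       ∎
      where open ≡-Reasoning

  minor-Iso : ∀ w → Iso (minor w M x) (minor w M′ y)
  minor-Iso w = record { perm = σ′ ; pres = λ S → begin
    indep (minor w M′ y) (image σ′ S)                                ≡⟨ minor-indep w M′ y _ ⟩
    indep M′ (insertAt (image σ′ S) y (insertedValue w M′ y))        ≡⟨ cong (λ v → indep M′ (insertAt _ y v))
                                                                          (insertedValue-≡ (Iso-indep-⁅⁆ ψ x) w) ⟩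
    indep M′ (insertAt (image σ′ S) y (insertedValue w M x))         ≡⟨ cong (indep M′) (insertAt-image S _) ⟩
    indep M′ (image σ (insertAt S x (insertedValue w M x)))          ≡⟨ pres ψ _ ⟩
    indep M (insertAt S x (insertedValue w M x))                     ≡⟨ minor-indep w M x S ⟨
    indep (minor w M x) S                                            ∎ }
    where open ≡-Reasoning

  private
    sign-≡ : ∀ s → sgn σ′ *ˢ (signPow (toℕ x) *ˢ s) ≡ signPow (toℕ y) *ˢ (sgn σ *ˢ s)
    sign-≡ s = begin
      sgn σ′ *ˢ (px *ˢ s)                    ≡⟨ cong (_*ˢ (sgn σ′ *ˢ (px *ˢ s))) (Sign.s*s≡+ py) ⟨
      (py *ˢ py) *ˢ (sgn σ′ *ˢ (px *ˢ s))    ≡⟨ solve 4 (λ px py σ′ s → (py ⊛ py) ⊛ (σ′ ⊛ (px ⊛ s))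
                                                                    ⊜ py ⊛ (((px ⊛ py) ⊛ σ′) ⊛ s)) refl px py (sgn σ′) s ⟩
      py *ˢ (((px *ˢ py) *ˢ sgn σ′) *ˢ s)    ≡⟨ cong (λ t → py *ˢ (t *ˢ s)) sgn-σ ⟨
      py *ˢ (sgn σ *ˢ s)                     ∎
      where
      open ≡-Reasoning
      px = signPow (toℕ x)
      py = signPow (toℕ y)
      sgn-σ : sgn σ ≡ (px *ˢ py) *ˢ sgn σ′
      sgn-σ = trans (sgn-remove σ x) (cong (_*ˢ sgn σ′) (signPow-+ (toℕ x) (toℕ y)))

  ∂term-Iso : ∀ w s → ∂term w M s x ≈ ∂term w M′ (sgn σ *ˢ s) y
  ∂term-Iso w s = if-𝟘-cong (select-≡ (sym (Iso-indep-⁅⁆ ψ x)) w (Iso-isColoop⇔ ψ x)) λ _ →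
    ≈-trans (rel-iso (minor-Iso w) _) (≈-reflexive (cong (gen (minor w M′ y)) (sign-≡ s)))

∂gen-Iso : ∀ w {k} {M M′ : SetSystem k} (ψ : Iso M M′) s → ∂gen w M s ≈ ∂gen w M′ (sgn (perm ψ) *ˢ s)
∂gen-Iso w {zero}  ψ s = ≈-refl
∂gen-Iso w {suc k} {M} {M′} ψ s = begin
  ∂gen w M s                                  ≡⟨ ∂gen≡sum w M s ⟩
  sum (∂term w M s)                           ≈⟨ sum-cong-≋ (λ x → ∂term-Iso ψ x w s) ⟩
  sum (∂term w M′ s′ ∘ (perm ψ ⟨$⟩ʳ_))        ≈⟨ sum-permute (∂term w M′ s′) (perm ψ) ⟨
  sum (∂term w M′ s′)                         ≡⟨ ∂gen≡sum w M′ s′ ⟨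
  ∂gen w M′ s′                                ∎
  where
  open ≈-Reasoning
  s′ = sgn (perm ψ) *ˢ s

∂gen-opposite : ∀ w {k} (M : SetSystem k) s → ∂gen w M (opposite s) ≈ (- 1ℚ) · ∂gen w M s
∂gen-opposite w {k} M s = begin
  ∂gen w M (opposite s)                   ≡⟨ ∂gen≡sum w M (opposite s) ⟩
  sum (∂term w M (opposite s))            ≈⟨ sum-cong-≋ (∂term-opposite {k}) ⟩
  sum (λ x → (- 1ℚ) · ∂term w M s x)      ≈⟨ ·-sum (- 1ℚ) (∂term w M s) ⟨
  (- 1ℚ) · sum (∂term w M s)              ≡⟨ cong ((- 1ℚ) ·_) (∂gen≡sum w M s) ⟨
  (- 1ℚ) · ∂gen w M s                     ∎
  where
  open ≈-Reasoning
  ∂term-opposite : ∀ {k} {M : SetSystem k} x → ∂term w M (opposite s) x ≈ (- 1ℚ) · ∂term w M s x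
  ∂term-opposite {suc k} {M} x with select w M x
  ... | true  = ≈-trans (≈-reflexive (cong (gen _) (*ˢ-opposite (signPow (toℕ x)) s))) (rel-sign _ _)
  ... | false = ≈-sym (·-zeroʳ _)

∂-cong : ∀ w {a b} → a ≈ b → ∂ w a ≈ ∂ w b
∂-cong w ≈-refl            = ≈-refl
∂-cong w (≈-sym p)         = ≈-sym (∂-cong w p)
∂-cong w (≈-trans p q)     = ≈-trans (∂-cong w p) (∂-cong w q)
∂-cong w (⊕-cong p q)      = ⊕-cong (∂-cong w p) (∂-cong w q)
∂-cong w (·-cong p)        = ·-cong (∂-cong w p)
∂-cong w (⊕-assoc _ _ _)   = ⊕-assoc _ _ _
∂-cong w (⊕-comm _ _)      = ⊕-comm _ _
∂-cong w (⊕-idˡ _)         = ⊕-idˡ _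
∂-cong w (⊕-invˡ _)        = ⊕-invˡ _
∂-cong w (·-one _)         = ·-one _
∂-cong w (·-assoc _ _ _)   = ·-assoc _ _ _
∂-cong w (·-distʳ _ _ _)   = ·-distʳ _ _ _
∂-cong w (·-distˡ _ _ _)   = ·-distˡ _ _ _
∂-cong w (rel-sign M s)    = ∂gen-opposite w M s
∂-cong w (rel-iso ψ s)     = ∂gen-Iso w ψ s

genL-cong : ∀ {m} (M : SetSystem m) s {b b′} → b ≈ b′ → genL M s b ≈ genL M s b′
genL-cong M s ≈-refl            = ≈-refl
genL-cong M s (≈-sym p)         = ≈-sym (genL-cong M s p)
genL-cong M s (≈-trans p q)     = ≈-trans (genL-cong M s p) (genL-cong M s q)
genL-cong M s (⊕-cong p q)      = ⊕-cong (genL-cong M s p) (genL-cong M s q)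
genL-cong M s (·-cong p)        = ·-cong (genL-cong M s p)
genL-cong M s (⊕-assoc _ _ _)   = ⊕-assoc _ _ _
genL-cong M s (⊕-comm _ _)      = ⊕-comm _ _
genL-cong M s (⊕-idˡ _)         = ⊕-idˡ _
genL-cong M s (⊕-invˡ _)        = ⊕-invˡ _
genL-cong M s (·-one _)         = ·-one _
genL-cong M s (·-assoc _ _ _)   = ·-assoc _ _ _
genL-cong M s (·-distʳ _ _ _)   = ·-distʳ _ _ _
genL-cong M s (·-distˡ _ _ _)   = ·-distˡ _ _ _
genL-cong M s (rel-sign Q t)    = ≈-trans (≈-reflexive (cong (gen (M ⊕ₘ Q)) (*ˢ-opposite s t))) (rel-sign _ _)
genL-cong {m} M s (rel-iso {M' = Q′} φ t) =
  ≈-trans (rel-iso (Iso-⊕ₘ (Iso-refl M) φ) (s *ˢ t)) (≈-reflexive (cong (gen (M ⊕ₘ Q′)) sign-≡))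
  where
  sign-≡ : sgn (Perm.id {m} ⊕ₚ perm φ) *ˢ (s *ˢ t) ≡ s *ˢ (sgn (perm φ) *ˢ t)
  sign-≡ = trans (cong (_*ˢ (s *ˢ t)) (trans (sgn-⊕ₚ (Perm.id {m}) (perm φ))
                                              (cong (_*ˢ sgn (perm φ)) (sgn-id {m}))))
                 (solve 3 (λ a s t → a ⊛ (s ⊛ t) ⊜ s ⊛ (a ⊛ t)) refl (sgn (perm φ)) s t)

genL-opposite : ∀ {m} (M : SetSystem m) s b → genL M (opposite s) b ≈ (- 1ℚ) · genL M s b
genL-opposite M s (gen Q t) = ≈-trans (≈-reflexive (cong (gen _) (Sign.*-assoc ⁻ s t))) (rel-sign _ _)
genL-opposite M s 𝟘         = ≈-sym (·-zeroʳ _)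
genL-opposite M s (b ⊕ c)   = ≈-trans (⊕-cong (genL-opposite M s b) (genL-opposite M s c)) (≈-sym (·-distˡ _ _ _))
genL-opposite M s (q · b)   = ≈-trans (·-cong (genL-opposite M s b)) (·-comm q (- 1ℚ) _)

genL-Iso : ∀ {m} {M M′ : SetSystem m} (ψ : Iso M M′) s b → genL M s b ≈ genL M′ (sgn (perm ψ) *ˢ s) b
genL-Iso {M′ = M′} ψ s (gen {n} Q t) =
  ≈-trans (rel-iso (Iso-⊕ₘ ψ (Iso-refl Q)) (s *ˢ t)) (≈-reflexive (cong (gen (M′ ⊕ₘ Q)) sign-≡))
  where
  sign-≡ : sgn (perm ψ ⊕ₚ Perm.id {n}) *ˢ (s *ˢ t) ≡ (sgn (perm ψ) *ˢ s) *ˢ t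
  sign-≡ = trans (cong (_*ˢ (s *ˢ t)) (trans (sgn-⊕ₚ (perm ψ) (Perm.id {n}))
                                              (trans (cong (sgn (perm ψ) *ˢ_) (sgn-id {n}))
                                                     (Sign.*-identityʳ (sgn (perm ψ))))))
                 (sym (Sign.*-assoc (sgn (perm ψ)) s t))
genL-Iso ψ s 𝟘       = ≈-refl
genL-Iso ψ s (b ⊕ c) = ⊕-cong (genL-Iso ψ s b) (genL-Iso ψ s c)
genL-Iso ψ s (q · b) = ·-cong (genL-Iso ψ s b)

⋆-congˡ : ∀ {a a′} b → a ≈ a′ → a ⋆ b ≈ a′ ⋆ b
⋆-congˡ b ≈-refl            = ≈-refl
⋆-congˡ b (≈-sym p)         = ≈-sym (⋆-congˡ b p)
⋆-congˡ b (≈-trans p q)     = ≈-trans (⋆-congˡ b p) (⋆-congˡ b q)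
⋆-congˡ b (⊕-cong p q)      = ⊕-cong (⋆-congˡ b p) (⋆-congˡ b q)
⋆-congˡ b (·-cong p)        = ·-cong (⋆-congˡ b p)
⋆-congˡ b (⊕-assoc _ _ _)   = ⊕-assoc _ _ _
⋆-congˡ b (⊕-comm _ _)      = ⊕-comm _ _
⋆-congˡ b (⊕-idˡ _)         = ⊕-idˡ _
⋆-congˡ b (⊕-invˡ _)        = ⊕-invˡ _
⋆-congˡ b (·-one _)         = ·-one _
⋆-congˡ b (·-assoc _ _ _)   = ·-assoc _ _ _
⋆-congˡ b (·-distʳ _ _ _)   = ·-distʳ _ _ _
⋆-congˡ b (·-distˡ _ _ _)   = ·-distˡ _ _ _
⋆-congˡ b (rel-sign M s)    = genL-opposite M s b
⋆-congˡ b (rel-iso ψ s)     = genL-Iso ψ s b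

⋆-congʳ : ∀ a {b b′} → b ≈ b′ → a ⋆ b ≈ a ⋆ b′
⋆-congʳ (gen M s) p = genL-cong M s p
⋆-congʳ 𝟘         p = ≈-refl
⋆-congʳ (a ⊕ c)   p = ⊕-cong (⋆-congʳ a p) (⋆-congʳ c p)
⋆-congʳ (q · a)   p = ·-cong (⋆-congʳ a p)

⋆-cong : ∀ {a a′ b b′} → a ≈ a′ → b ≈ b′ → a ⋆ b ≈ a′ ⋆ b′
⋆-cong {a′ = a′} {b} a≈a′ b≈b′ = ≈-trans (⋆-congˡ b a≈a′) (⋆-congʳ a′ b≈b′)

-- Bases and direct sums

module _ {n} (M : SetSystem n) where

  isBasis-or-extensible : ∀ {B} → indep M B ≡ true → IsBasis M B ⊎ Σ (Subset n) (λ T → B ⊂ T × indep M T ≡ true)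
  isBasis-or-extensible {B} indB with Subset.anySubset? (λ T → (B Subset.⊂? T) ×-dec (indep M T Bool.≟ true))
  ... | yes larger = inj₂ larger
  ... | no ∄larger = inj₁ (indB , λ T B⊆T indT → sym (⊆-⊄⇒≡ B⊆T (λ B⊂T → ∄larger (T , B⊂T , indT))))

  private
    -- Each step strictly enlarges B, so n ≤ k + ∣ B ∣ guarantees that k steps suffice.
    extendToBasis : ∀ k {B} → indep M B ≡ true → n ≤ k + ∣ B ∣ → Σ (Subset n) (IsBasis M)
    extendToBasis k {B} indB bound with isBasis-or-extensible indB
    ... | inj₁ basisB = B , basisB
    extendToBasis zero    {B} indB bound | inj₂ (T , B⊂T , _) =
      ⊥-elim (ℕ.<⇒≱ (Subset.p⊂q⇒∣p∣<∣q∣ B⊂T) (ℕ.≤-trans (Subset.∣p∣≤n T) bound))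
    extendToBasis (suc k) {B} indB bound | inj₂ (T , B⊂T , indT) = extendToBasis k indT
      (ℕ.≤-trans bound (ℕ.≤-trans (ℕ.≤-reflexive (sym (ℕ.+-suc k ∣ B ∣)))
                                  (ℕ.+-monoʳ-≤ k (Subset.p⊂q⇒∣p∣<∣q∣ B⊂T))))

  basis-exists : indep M ∅ ≡ true → Σ (Subset n) (IsBasis M)
  basis-exists ind∅ = extendToBasis n ind∅ (ℕ.m≤m+n n _)

module _ {m n} (M : SetSystem m) (Q : SetSystem n) where

  indep-⊕ₘ-++ : ∀ U V → indep (M ⊕ₘ Q) (U ++ V) ≡ indep M U ∧ indep Q V
  indep-⊕ₘ-++ U V = cong₂ (λ U V → indep M U ∧ indep Q V) (take-++ U V) (drop-++ U V)

  ⊕ₘ-isBasis⁻ : ∀ {U V} → IsBasis (M ⊕ₘ Q) (U ++ V) → IsBasis M U × IsBasis Q V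
  ⊕ₘ-isBasis⁻ {U} {V} (indUV , maximal) =
    (indU , λ T U⊆T indT → Vec.++-injectiveˡ T U
      (maximal (T ++ V) (++⁺-⊆ U⊆T (λ k∈ → k∈)) (trans (indep-⊕ₘ-++ T V) (cong₂ _∧_ indT indV)))) ,
    (indV , λ T V⊆T indT → Vec.++-injectiveʳ U U
      (maximal (U ++ T) (++⁺-⊆ (λ k∈ → k∈) V⊆T) (trans (indep-⊕ₘ-++ U T) (cong₂ _∧_ indU indT))))
    where
    indU×indV = ∧≡true⁻ (trans (sym (indep-⊕ₘ-++ U V)) indUV)
    indU = proj₁ indU×indV
    indV = proj₂ indU×indV

  ⊕ₘ-isBasis⁺ : ∀ {U V} → IsBasis M U → IsBasis Q V → IsBasis (M ⊕ₘ Q) (U ++ V)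
  ⊕ₘ-isBasis⁺ {U} {V} (indU , maximalU) (indV , maximalV) =
    trans (indep-⊕ₘ-++ U V) (cong₂ _∧_ indU indV) , λ T UV⊆T indT →
      let UV⊆T′ = subst (λ T → U ++ V ⊆ T) (sym (Vec.take++drop≡id m T)) UV⊆T
          indT₁×indT₂ = ∧≡true⁻ indT
      in trans (sym (Vec.take++drop≡id m T))
               (cong₂ _++_ (maximalU _ (++⁻-⊆ˡ UV⊆T′) (proj₁ indT₁×indT₂))
                           (maximalV _ (++⁻-⊆ʳ {U = U} UV⊆T′) (proj₂ indT₁×indT₂)))

  ⊕ₘ-isBasis-take-drop : ∀ {B} → IsBasis (M ⊕ₘ Q) B → IsBasis M (take m B) × IsBasis Q (drop m B)
  ⊕ₘ-isBasis-take-drop {B} basisB =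
    ⊕ₘ-isBasis⁻ (subst (IsBasis (M ⊕ₘ Q)) (sym (Vec.take++drop≡id m B)) basisB)

  ⊕ₘ-isColoop-↑ˡ : Σ (Subset n) (IsBasis Q) → ∀ i → IsColoop (M ⊕ₘ Q) (i ↑ˡ n) ⇔ IsColoop M i
  ⊕ₘ-isColoop-↑ˡ (B₂ , basisB₂) i = mk⇔
    (λ coloop B₁ basisB₁ → ∈-++⁻ˡ (coloop _ (⊕ₘ-isBasis⁺ basisB₁ basisB₂)))
    (λ coloop B basisB → ∈-take-drop m (∈-++⁺ˡ (coloop _ (proj₁ (⊕ₘ-isBasis-take-drop basisB)))))

  ⊕ₘ-isColoop-↑ʳ : Σ (Subset m) (IsBasis M) → ∀ j → IsColoop (M ⊕ₘ Q) (m ↑ʳ j) ⇔ IsColoop Q j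
  ⊕ₘ-isColoop-↑ʳ (B₁ , basisB₁) j = mk⇔
    (λ coloop B₂ basisB₂ → ∈-++⁻ʳ {U = B₁} (coloop _ (⊕ₘ-isBasis⁺ basisB₁ basisB₂)))
    (λ coloop B basisB → ∈-take-drop m (∈-++⁺ʳ (coloop _ (proj₂ (⊕ₘ-isBasis-take-drop basisB)))))

  indep-⁅↑ˡ⁆ : indep Q ∅ ≡ true → ∀ i → indep (M ⊕ₘ Q) ⁅ i ↑ˡ n ⁆ ≡ indep M ⁅ i ⁆
  indep-⁅↑ˡ⁆ indQ∅ i = trans (cong (indep (M ⊕ₘ Q)) (⁅↑ˡ⁆ n i))
    (trans (indep-⊕ₘ-++ ⁅ i ⁆ ∅) (trans (cong (indep M ⁅ i ⁆ ∧_) indQ∅) (Bool.∧-identityʳ _)))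

  indep-⁅↑ʳ⁆ : indep M ∅ ≡ true → ∀ j → indep (M ⊕ₘ Q) ⁅ m ↑ʳ j ⁆ ≡ indep Q ⁅ j ⁆
  indep-⁅↑ʳ⁆ indM∅ j = trans (cong (indep (M ⊕ₘ Q)) (⁅↑ʳ⁆ m j))
    (trans (indep-⊕ₘ-++ ∅ ⁅ j ⁆) (cong (_∧ indep Q ⁅ j ⁆) indM∅))

-- The Leibniz rule

∂term-⊕ₘ-↑ˡ : ∀ w {m n} (M : SetSystem m) (Q : SetSystem n) → indep Q ∅ ≡ true →
              ∀ s t i → ∂term w (M ⊕ₘ Q) (s *ˢ t) (i ↑ˡ n) ≈ ∂term w M s i ⋆ gen Q t
∂term-⊕ₘ-↑ˡ w {suc m} {n} M Q indQ∅ s t i = ≈-trans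
  (if-𝟘-cong (select-≡ (indep-⁅↑ˡ⁆ M Q indQ∅ i) w (⊕ₘ-isColoop-↑ˡ M Q (basis-exists Q indQ∅) i)) λ _ →
    ≈-trans (gen-cong _ minor-≗) (≈-reflexive (cong (gen (minor w M i ⊕ₘ Q)) sign-≡)))
  (≈-sym (if-𝟘-map (_⋆ gen Q t) ≈-refl (select w M i)))
  where
  v = insertedValue w (M ⊕ₘ Q) (i ↑ˡ n)
  minor-≗ : ∀ S → indep (minor w (M ⊕ₘ Q) (i ↑ˡ n)) S ≡ indep (minor w M i ⊕ₘ Q) S
  minor-≗ S = begin
    indep (minor w (M ⊕ₘ Q) (i ↑ˡ n)) S
      ≡⟨ minor-indep w (M ⊕ₘ Q) (i ↑ˡ n) S ⟩
    indep M (take (suc m) (insertAt S (i ↑ˡ n) v)) ∧ indep Q (drop (suc m) (insertAt S (i ↑ˡ n) v))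
      ≡⟨ cong₂ _∧_ (cong (indep M) (take-insertAt-↑ˡ S i v)) (cong (indep Q) (drop-insertAt-↑ˡ S i v)) ⟩
    indep M (insertAt (take m S) i v) ∧ indep Q (drop m S)
      ≡⟨ cong (λ v → indep M (insertAt (take m S) i v) ∧ indep Q (drop m S))
              (insertedValue-≡ (indep-⁅↑ˡ⁆ M Q indQ∅ i) w) ⟩
    indep M (insertAt (take m S) i (insertedValue w M i)) ∧ indep Q (drop m S)
      ≡⟨ cong (_∧ indep Q (drop m S)) (minor-indep w M i (take m S)) ⟨
    indep (minor w M i ⊕ₘ Q) S
      ∎
    where open ≡-Reasoning
  sign-≡ : signPow (toℕ (i ↑ˡ n)) *ˢ (s *ˢ t) ≡ (signPow (toℕ i) *ˢ s) *ˢ t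
  sign-≡ = trans (cong (λ k → signPow k *ˢ (s *ˢ t)) (Fin.toℕ-↑ˡ i n)) (sym (Sign.*-assoc (signPow (toℕ i)) s t))

-- ∂term only unfolds on ground sets Fin (suc k), hence the split on m. When M has suc m
-- elements, the minor lives on Fin (m + suc n) but M ⊕ₘ minor w Q j on Fin (suc m + n).
∂term-⊕ₘ-↑ʳ : ∀ w m {n} (M : SetSystem m) (Q : SetSystem n) → indep M ∅ ≡ true →
              ∀ s t j → ∂term w (M ⊕ₘ Q) (s *ˢ t) (m ↑ʳ j) ≈ negOnePow m · genL M s (∂term w Q t j)
∂term-⊕ₘ-↑ʳ w zero {suc n} M Q indM∅ s t j = ≈-trans
  (if-𝟘-cong (select-≡ (indep-⁅↑ʳ⁆ M Q indM∅ j) w (⊕ₘ-isColoop-↑ʳ M Q (basis-exists M indM∅) j)) λ _ →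
    ≈-trans (gen-cong _ minor-≗) (≈-trans (≈-reflexive (cong (gen (M ⊕ₘ minor w Q j)) sign-≡)) (≈-sym (·-one _))))
  (≈-sym (if-𝟘-map (λ a → negOnePow 0 · genL M s a) (·-zeroʳ _) (select w Q j)))
  where
  minor-≗ : ∀ S → indep (minor w (M ⊕ₘ Q) j) S ≡ indep (M ⊕ₘ minor w Q j) S
  minor-≗ S = begin
    indep (minor w (M ⊕ₘ Q) j) S
      ≡⟨ minor-indep w (M ⊕ₘ Q) j S ⟩
    indep M [] ∧ indep Q (insertAt S j (insertedValue w (M ⊕ₘ Q) j))
      ≡⟨ cong (λ v → indep M [] ∧ indep Q (insertAt S j v)) (insertedValue-≡ (indep-⁅↑ʳ⁆ M Q indM∅ j) w) ⟩
    indep M [] ∧ indep Q (insertAt S j (insertedValue w Q j))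
      ≡⟨ cong (indep M [] ∧_) (minor-indep w Q j S) ⟨
    indep (M ⊕ₘ minor w Q j) S
      ∎
    where open ≡-Reasoning
  sign-≡ : signPow (toℕ j) *ˢ (s *ˢ t) ≡ s *ˢ (signPow (toℕ j) *ˢ t)
  sign-≡ = solve 3 (λ a s t → a ⊛ (s ⊛ t) ⊜ s ⊛ (a ⊛ t)) refl (signPow (toℕ j)) s t
∂term-⊕ₘ-↑ʳ w (suc m) {suc n} M Q indM∅ s t j = ≈-trans
  (if-𝟘-cong (select-≡ (indep-⁅↑ʳ⁆ M Q indM∅ j) w (⊕ₘ-isColoop-↑ʳ M Q (basis-exists M indM∅) j)) λ _ →
    ≈-trans (gen-cast p _ minor-≗)
            (≈-trans (≈-reflexive (cong (gen (M ⊕ₘ minor w Q j)) sign-≡)) (≈-sym (negOnePow·gen (suc m) _ _))))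
  (≈-sym (if-𝟘-map (λ a → negOnePow (suc m) · genL M s a) (·-zeroʳ _) (select w Q j)))
  where
  p : m + suc n ≡ suc m + n
  p = ℕ.+-suc m n
  x = suc m ↑ʳ j
  v = insertedValue w (M ⊕ₘ Q) x
  minor-≗ : ∀ S → indep (minor w (M ⊕ₘ Q) x) S ≡ indep (M ⊕ₘ minor w Q j) (cast p S)
  minor-≗ S = begin
    indep (minor w (M ⊕ₘ Q) x) S
      ≡⟨ minor-indep w (M ⊕ₘ Q) x S ⟩
    indep M (take (suc m) (insertAt S x v)) ∧ indep Q (drop (suc m) (insertAt S x v))
      ≡⟨ cong₂ _∧_ (cong (indep M) (take-insertAt-↑ʳ m S j v p)) (cong (indep Q) (drop-insertAt-↑ʳ m S j v p)) ⟩
    indep M (take (suc m) (cast p S)) ∧ indep Q (insertAt (drop (suc m) (cast p S)) j v)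
      ≡⟨ cong (λ v → indep M (take (suc m) (cast p S)) ∧ indep Q (insertAt (drop (suc m) (cast p S)) j v))
              (insertedValue-≡ (indep-⁅↑ʳ⁆ M Q indM∅ j) w) ⟩
    indep M (take (suc m) (cast p S)) ∧ indep Q (insertAt (drop (suc m) (cast p S)) j (insertedValue w Q j))
      ≡⟨ cong (indep M (take (suc m) (cast p S)) ∧_) (minor-indep w Q j _) ⟨
    indep (M ⊕ₘ minor w Q j) (cast p S)
      ∎
    where open ≡-Reasoning
  sign-≡ : signPow (toℕ x) *ˢ (s *ˢ t) ≡ signPow (suc m) *ˢ (s *ˢ (signPow (toℕ j) *ˢ t))
  sign-≡ = begin
    signPow (toℕ x) *ˢ (s *ˢ t)                        ≡⟨ cong (λ k → signPow k *ˢ (s *ˢ t)) (Fin.toℕ-↑ʳ (suc m) j) ⟩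
    signPow (suc m + toℕ j) *ˢ (s *ˢ t)                ≡⟨ cong (_*ˢ (s *ˢ t)) (signPow-+ (suc m) (toℕ j)) ⟩
    (signPow (suc m) *ˢ signPow (toℕ j)) *ˢ (s *ˢ t)   ≡⟨ solve 4 (λ a b s t → (a ⊛ b) ⊛ (s ⊛ t) ⊜ a ⊛ (s ⊛ (b ⊛ t)))
                                                            refl (signPow (suc m)) (signPow (toℕ j)) s t ⟩
    signPow (suc m) *ˢ (s *ˢ (signPow (toℕ j) *ˢ t))   ∎
    where open ≡-Reasoning

sum-⋆ : ∀ {k} (f : Fin k → Term) b → sum f ⋆ b ≡ sum (λ i → f i ⋆ b)
sum-⋆ {zero}  f b = refl
sum-⋆ {suc k} f b = cong (f fzero ⋆ b ⊕_) (sum-⋆ (f ∘ fsuc) b)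

genL-sum : ∀ {m} (M : SetSystem m) s {k} (f : Fin k → Term) → genL M s (sum f) ≡ sum (genL M s ∘ f)
genL-sum M s {zero}  f = refl
genL-sum M s {suc k} f = cong (genL M s (f fzero) ⊕_) (genL-sum M s (f ∘ fsuc))

∂gen-⊕ₘ : ∀ w {m n} (M : SetSystem m) (Q : SetSystem n) → indep M ∅ ≡ true → indep Q ∅ ≡ true → ∀ s t →
          ∂gen w (M ⊕ₘ Q) (s *ˢ t) ≈ ∂gen w M s ⋆ gen Q t ⊕ negOnePow m · genL M s (∂gen w Q t)
∂gen-⊕ₘ w {m} {n} M Q indM∅ indQ∅ s t = begin
  ∂gen w (M ⊕ₘ Q) (s *ˢ t)
    ≡⟨ ∂gen≡sum w (M ⊕ₘ Q) (s *ˢ t) ⟩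
  sum (∂term w (M ⊕ₘ Q) (s *ˢ t))
    ≈⟨ sum-↑ (CommutativeMonoid.monoid ⊕-𝟘-commutativeMonoid) m _ ⟩
  sum (λ i → ∂term w (M ⊕ₘ Q) (s *ˢ t) (i ↑ˡ n)) ⊕ sum (λ j → ∂term w (M ⊕ₘ Q) (s *ˢ t) (m ↑ʳ j))
    ≈⟨ ⊕-cong (sum-cong-≋ (∂term-⊕ₘ-↑ˡ w M Q indQ∅ s t)) (sum-cong-≋ (∂term-⊕ₘ-↑ʳ w m M Q indM∅ s t)) ⟩
  sum (λ i → ∂term w M s i ⋆ gen Q t) ⊕ sum (λ j → negOnePow m · genL M s (∂term w Q t j))
    ≈⟨ ⊕-cong ≈-refl (·-sum (negOnePow m) (genL M s ∘ ∂term w Q t)) ⟨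
  sum (λ i → ∂term w M s i ⋆ gen Q t) ⊕ negOnePow m · sum (λ j → genL M s (∂term w Q t j))
    ≡⟨ cong₂ (λ a b → a ⊕ negOnePow m · b) (sum-⋆ (∂term w M s) (gen Q t)) (genL-sum M s (∂term w Q t)) ⟨
  sum (∂term w M s) ⋆ gen Q t ⊕ negOnePow m · genL M s (sum (∂term w Q t))
    ≡⟨ cong₂ (λ a b → a ⋆ gen Q t ⊕ negOnePow m · genL M s b) (∂gen≡sum w M s) (∂gen≡sum w Q t) ⟨
  ∂gen w M s ⋆ gen Q t ⊕ negOnePow m · genL M s (∂gen w Q t)
    ∎
  where open ≈-Reasoning

⋆-zeroʳ : ∀ a → a ⋆ 𝟘 ≈ 𝟘
⋆-zeroʳ (gen M s) = ≈-refl
⋆-zeroʳ 𝟘         = ≈-refl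
⋆-zeroʳ (a ⊕ c)   = ≈-trans (⊕-cong (⋆-zeroʳ a) (⋆-zeroʳ c)) (⊕-idˡ 𝟘)
⋆-zeroʳ (q · a)   = ≈-trans (·-cong (⋆-zeroʳ a)) (·-zeroʳ q)

⋆-distribˡ-⊕ : ∀ a b c → a ⋆ (b ⊕ c) ≈ a ⋆ b ⊕ a ⋆ c
⋆-distribˡ-⊕ (gen M s) b c = ≈-refl
⋆-distribˡ-⊕ 𝟘         b c = ≈-sym (⊕-idˡ 𝟘)
⋆-distribˡ-⊕ (a ⊕ a′)  b c = ≈-trans (⊕-cong (⋆-distribˡ-⊕ a b c) (⋆-distribˡ-⊕ a′ b c)) (interchange _ _ _ _)
⋆-distribˡ-⊕ (q · a)   b c = ≈-trans (·-cong (⋆-distribˡ-⊕ a b c)) (·-distˡ _ _ _)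

⋆-·ʳ : ∀ a q b → a ⋆ (q · b) ≈ q · (a ⋆ b)
⋆-·ʳ (gen M s) q b = ≈-refl
⋆-·ʳ 𝟘         q b = ≈-sym (·-zeroʳ q)
⋆-·ʳ (a ⊕ a′)  q b = ≈-trans (⊕-cong (⋆-·ʳ a q b) (⋆-·ʳ a′ q b)) (≈-sym (·-distˡ _ _ _))
⋆-·ʳ (p · a)   q b = ≈-trans (·-cong (⋆-·ʳ a q b)) (·-comm p q _)

module _ (ε : ℚ) where

  leibniz-⊕ : ∀ {A B X X′ Y Y′} → A ≈ X ⊕ ε · Y → B ≈ X′ ⊕ ε · Y′ → A ⊕ B ≈ (X ⊕ X′) ⊕ ε · (Y ⊕ Y′)
  leibniz-⊕ A≈ B≈ = ≈-trans (⊕-cong A≈ B≈) (≈-trans (interchange _ _ _ _) (⊕-cong ≈-refl (≈-sym (·-distˡ _ _ _))))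

  leibniz-· : ∀ q {A X Y} → A ≈ X ⊕ ε · Y → q · A ≈ q · X ⊕ ε · (q · Y)
  leibniz-· q A≈ = ≈-trans (·-cong A≈) (≈-trans (·-distˡ _ _ _) (⊕-cong ≈-refl (·-comm q ε _)))

∂-genL : ∀ w {d} e (M : SetSystem d) → indep M ∅ ≡ true → ∀ s b → AllDeg e b →
         ∂ w (genL M s b) ≈ ∂gen w M s ⋆ b ⊕ negOnePow d · genL M s (∂ w b)
∂-genL w e M indM∅ s _ (gen Q t isMatroidQ) = ∂gen-⊕ₘ w M Q indM∅ (IsMatroid.I1 isMatroidQ) s t
∂-genL w e M indM∅ s _ 𝟘 = ≈-sym (≈-trans (⊕-cong (⋆-zeroʳ (∂gen w M s)) (·-zeroʳ _)) (⊕-idˡ 𝟘))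
∂-genL w {d} e M indM∅ s _ (_⊕_ {b} {c} degB degC) =
  ≈-trans (leibniz-⊕ (negOnePow d) (∂-genL w e M indM∅ s b degB) (∂-genL w e M indM∅ s c degC))
          (⊕-cong (≈-sym (⋆-distribˡ-⊕ (∂gen w M s) b c)) ≈-refl)
∂-genL w {d} e M indM∅ s _ (q · degB) =
  ≈-trans (leibniz-· (negOnePow d) q (∂-genL w e M indM∅ s _ degB))
          (⊕-cong (≈-sym (⋆-·ʳ (∂gen w M s) q _)) ≈-refl)

∂-⋆ : ∀ w d e a b → AllDeg d a → AllDeg e b → ∂ w (a ⋆ b) ≈ ∂ w a ⋆ b ⊕ negOnePow d · (a ⋆ ∂ w b)
∂-⋆ w d e _ b (gen M s isMatroidM) degB = ∂-genL w e M (IsMatroid.I1 isMatroidM) s b degB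
∂-⋆ w d e _ b 𝟘                    degB = ≈-sym (≈-trans (⊕-cong ≈-refl (·-zeroʳ _)) (⊕-idˡ 𝟘))
∂-⋆ w d e _ b (degA ⊕ degA′)        degB = leibniz-⊕ (negOnePow d) (∂-⋆ w d e _ b degA degB) (∂-⋆ w d e _ b degA′ degB)
∂-⋆ w d e _ b (q · degA)            degB = leibniz-· (negOnePow d) q (∂-⋆ w d e _ b degA degB)

lemma5p4 : (w : Which) (d e : ℕ) (a b : Term) →
           Homogeneous d a → Homogeneous e b →
           ∂ w (a ⋆ b) ≈ ∂ w a ⋆ b ⊕ negOnePow d · (a ⋆ ∂ w b)
lemma5p4 w d e a b (a′ , a≈a′ , degA′) (b′ , b≈b′ , degB′) = begin
  ∂ w (a ⋆ b)                                ≈⟨ ∂-cong w (⋆-cong a≈a′ b≈b′) ⟩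
  ∂ w (a′ ⋆ b′)                              ≈⟨ ∂-⋆ w d e a′ b′ degA′ degB′ ⟩
  ∂ w a′ ⋆ b′ ⊕ negOnePow d · (a′ ⋆ ∂ w b′)  ≈⟨ ⊕-cong (⋆-cong (∂-cong w a≈a′) b≈b′)
                                                       (·-cong (⋆-cong a≈a′ (∂-cong w b≈b′))) ⟨
  ∂ w a ⋆ b ⊕ negOnePow d · (a ⋆ ∂ w b)      ∎
  where open ≈-Reasoning
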